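{- For every integer $n\ge1$ and every $S\in\{\{g,o\},\{r,s\},\{b,y\}\}$, \[F(J(T_n(S)),q)=\prod_{j=1}^{n}{n\brack j}_q=\prod_{1\le i\le j\le k\le n-1}\frac{[j+1]_q}{[j]_q}.\]
   Context: For an integer $n\ge1$, let $T_n$ be the set of triples $(c_1,c_2,c_3)$ of nonnegative integers with $c_1+c_2+c_3\le n-2$. Six colors are associated to vectors: red $r=(1,0,0)$, green $g=(0,1,0)$, yellow $y=(0,0,1)$, blue $b=(-1,1,0)$, orange $o=(-1,0,1)$, silver $s=(0,1,-1)$. For $S\subseteq\{r,b,g,o,y,s\}$, $T_n(S)$ is the poset on $T_n$ whose order relation is the reflexive–transitive closure of the relations $u<u+v$ for all $u,u+v\in T_n$ and $v$ the vector of a color in $S$. $J(P)$ denotes the set of order ideals of a poset $P$ and $F(J(P),q)=\sum_{I\in J(P)}q^{|I|}$. Also $[m]_q=1+q+\dots+q^{m-1}$, $m!_q=[1]_q\cdots[m]_q$, and ${n\brack j}_q=\frac{n!_q}{j!_q\,(n-j)!_q}$. -}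

module Defs where

open import Data.Nat as ℕ using (ℕ; zero; suc; NonZero)
import Data.Nat.Properties as ℕP
open import Data.Integer as ℤ using (ℤ; +_; -[1+_])
import Data.Integer.Properties as ℤP
open import Data.Rational as ℚ using (ℚ; 1ℚ)
open import Data.Product using (_×_; _,_; Σ; ∃; ∃-syntax; proj₁; proj₂)
open import Data.List using (List; []; _∷_; _++_; map; concatMap; upTo; foldr; length; filter)
open import Data.Nat.ListAction using (sum)
open import Data.List.Membership.Propositional using (_∈_)
open import Data.List.Membership.DecPropositional using () renaming (_∈?_ to ∈?-gen)
open import Data.List.Relation.Unary.All as All using (All; all?)
open import Relation.Binary.Construct.Closure.ReflexiveTransitive using (Star; ε; _◅_)
open import Relation.Binary.PropositionalEquality using (_≡_; refl; sym; trans; cong; cong₂; subst)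
open import Relation.Binary.Definitions using (DecidableEquality)
open import Relation.Nullary using (Dec; yes; no; ¬_)
open import Relation.Nullary.Decidable using (map′; _×-dec_; _→-dec_)

Pt : Set
Pt = ℤ × ℤ × ℤ

_+₃_ : Pt → Pt → Pt
(a , b , c) +₃ (a' , b' , c') = (a ℤ.+ a') , (b ℤ.+ b') , (c ℤ.+ c')

_-₃_ : Pt → Pt → Pt
(a , b , c) -₃ (a' , b' , c') = (a ℤ.- a') , (b ℤ.- b') , (c ℤ.- c')

data Color : Set where
  red green yellow blue orange silver : Color

vec : Color → Pt
vec red    = + 1 , + 0 , + 0
vec green  = + 0 , + 1 , + 0
vec yellow = + 0 , + 0 , + 1
vec blue   = -[1+ 0 ] , + 1 , + 0
vec orange = -[1+ 0 ] , + 0 , + 1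
vec silver = + 0 , + 1 , -[1+ 0 ]

InT : ℕ → Pt → Set
InT n (a , b , c) =
  (+ 0 ℤ.≤ a) × (+ 0 ℤ.≤ b) × (+ 0 ℤ.≤ c) × (a ℤ.+ b ℤ.+ c ℤ.≤ + n ℤ.- + 2)

-- explicit enumeration of T_n (each element exactly once)
Tlist : ℕ → List Pt
Tlist zero          = []
Tlist (suc zero)    = []
Tlist (suc (suc m)) =
  concatMap (λ a →
    concatMap (λ b →
      map (λ c → + a , + b , + c) (upTo (suc (m ℕ.∸ a ℕ.∸ b))))
    (upTo (suc (m ℕ.∸ a))))
  (upTo (suc m))

Cover : List Color → ℕ → Pt → Pt → Set
Cover S n u w = InT n u × InT n w × ∃[ c ] (c ∈ S × w ≡ u +₃ vec c)

_≤[_,_]_ : Pt → List Color → ℕ → Pt → Set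
x ≤[ S , n ] y = Star (Cover S n) x y

IsIdeal : List Color → ℕ → List Pt → Set
IsIdeal S n I = ∀ x y → x ≤[ S , n ] y → y ∈ I → x ∈ I

subsets : {A : Set} → List A → List (List A)
subsets []       = [] ∷ []
subsets (x ∷ xs) = subsets xs ++ map (x ∷_) (subsets xs)

_≟₃_ : DecidableEquality Pt
(a , b , c) ≟₃ (a' , b' , c') with a ℤ.≟ a' | b ℤ.≟ b' | c ℤ.≟ c'
... | yes refl | yes refl | yes refl = yes refl
... | no p | _ | _ = no λ { refl → p refl }
... | yes _ | no p | _ = no λ { refl → p refl }
... | yes _ | yes _ | no p = no λ { refl → p refl }

InT? : ∀ n p → Dec (InT n p)
InT? n (a , b , c) =
  (+ 0 ℤ.≤? a) ×-dec (+ 0 ℤ.≤? b) ×-dec (+ 0 ℤ.≤? c) ×-dec (a ℤ.+ b ℤ.+ c ℤ.≤? + n ℤ.- + 2)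

_∈P?_ : ∀ (p : Pt) I → Dec (p ∈ I)
_∈P?_ = ∈?-gen _≟₃_

GenClosed : List Color → ℕ → List Pt → Set
GenClosed S n I =
  All (λ y → All (λ c → InT n y → InT n (y -₃ vec c) → (y -₃ vec c) ∈ I) S) I

GenClosed? : ∀ S n I → Dec (GenClosed S n I)
GenClosed? S n I =
  all? (λ y → all? (λ c → InT? n y →-dec (InT? n (y -₃ vec c) →-dec ((y -₃ vec c) ∈P? I))) S) I

private
  sub-add : ∀ (i j : ℤ) → (i ℤ.+ j) ℤ.- j ≡ i
  sub-add i j = trans (ℤP.+-assoc i j (ℤ.- j))
                (trans (cong (λ t → i ℤ.+ t) (ℤP.+-inverseʳ j)) (ℤP.+-identityʳ i))

  add-sub : ∀ (i j : ℤ) → (i ℤ.- j) ℤ.+ j ≡ i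
  add-sub i j = trans (ℤP.+-assoc i (ℤ.- j) j)
                (trans (cong (λ t → i ℤ.+ t) (ℤP.+-inverseˡ j)) (ℤP.+-identityʳ i))

  sub-add₃ : ∀ u v → (u +₃ v) -₃ v ≡ u
  sub-add₃ (a , b , c) (a' , b' , c') =
    cong₂ _,_ (sub-add a a') (cong₂ _,_ (sub-add b b') (sub-add c c'))

  add-sub₃ : ∀ u v → u ≡ (u -₃ v) +₃ v
  add-sub₃ (a , b , c) (a' , b' , c') =
    sym (cong₂ _,_ (add-sub a a') (cong₂ _,_ (add-sub b b') (add-sub c c')))

  gen⇒ideal : ∀ S n I → GenClosed S n I → IsIdeal S n I
  gen⇒ideal S n I g x .x ε y∈ = y∈
  gen⇒ideal S n I g x y ((inx , inz , c , c∈ , refl) ◅ rest) y∈ =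
    subst (_∈ I) (sub-add₃ x (vec c))
      (All.lookup (All.lookup g z∈) c∈ inz
        (subst (InT n) (sym (sub-add₃ x (vec c))) inx))
    where z∈ = gen⇒ideal S n I g _ y rest y∈

  ideal⇒gen : ∀ S n I → IsIdeal S n I → GenClosed S n I
  ideal⇒gen S n I id = All.tabulate λ {y} y∈ → All.tabulate λ {c} c∈ iny inx →
    id _ y ((inx , iny , c , c∈ , add-sub₃ y (vec c)) ◅ ε) y∈

IsIdeal? : ∀ S n I → Dec (IsIdeal S n I)
IsIdeal? S n I = map′ (gen⇒ideal S n I) (ideal⇒gen S n I) (GenClosed? S n I)

J : List Color → ℕ → List (List Pt)
J S n = filter (IsIdeal? S n) (subsets (Tlist n))

F : List Color → ℕ → ℕ → ℕ
F S n q = sum (map (λ I → q ℕ.^ length I) (J S n))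

qint : ℕ → ℕ → ℕ
qint m q = sum (map (q ℕ.^_) (upTo m))

qfact : ℕ → ℕ → ℕ
qfact zero    q = 1
qfact (suc m) q = qfact m q ℕ.* qint (suc m) q

qfact-nz : ∀ m q → NonZero (qfact m q)
qfact-nz zero    q = _
qfact-nz (suc m) q = ℕP.m*n≢0 (qfact m q) (qint (suc m) q) {{qfact-nz m q}}

qbinom : ℕ → ℕ → ℕ → ℚ
qbinom n j q = ℚ._/_ (+ qfact n q) (qfact j q ℕ.* qfact (n ℕ.∸ j) q)
  {{ℕP.m*n≢0 (qfact j q) (qfact (n ℕ.∸ j) q) {{qfact-nz j q}} {{qfact-nz (n ℕ.∸ j) q}}}}

-- [j+1]_q / [j]_q for j ≥ 1 (written with j = suc i)
qratio : ℕ → ℕ → ℚ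
qratio i q = ℚ._/_ (+ qint (suc (suc i)) q) (qint (suc i) q)

prodℚ : List ℚ → ℚ
prodℚ = foldr ℚ._*_ 1ℚ

from1 : ℕ → List ℕ
from1 m = map suc (upTo m)

prodBinom : ℕ → ℕ → ℚ
prodBinom n q = prodℚ (map (λ j → qbinom n j q) (from1 n))

prodRatio : ℕ → ℕ → ℚ
prodRatio n q =
  prodℚ (concatMap (λ k →
           concatMap (λ j →
             map (λ i → qratio (j ℕ.∸ 1) q) (from1 j))
           (from1 k))
         (from1 (n ℕ.∸ 1)))

gO rS bY : List Color
gO = green ∷ orange ∷ []
rS = red ∷ silver ∷ []
bY = blue ∷ yellow ∷ []

{-# OPTIONS --safe #-}
-- Write the points of T_n as (x, i, j). The covers u < u + b and u < u + y of T_n({b,y}) keep the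
-- level x + i fixed, so T_n({b,y}) is the disjoint union, over s = 0 … n−2, of the blocks of level s,
-- and (x, i, j) ↦ (i, j) identifies block s with the product of chains [s+1] × [n−1−s]. The colour
-- sets {g,o} and {r,s} are carried to {b,y} by swapping the last two, respectively the first and last,
-- coordinates. Order ideals of a disjoint union are tuples of ideals of the parts, and the ideals of
-- [a] × [b], counted by size, satisfy the q-Pascal recursion of [a+b choose a]_q: split on whether
-- the corner (a−1, 0) is in the ideal. If it is not, the last row is empty; if it is, the first
-- column is full and the rest is an ideal of [a] × [b−1].
-- After clearing denominators both equalities become identities between q-factorials, the second
-- one by induction on n using the telescoping ∏_{j≤k} ([j+1]/[j])^j = [k+1]^k / k!_q.
module Submission where

open import Defs
open import Data.Nat as ℕ using (ℕ; zero; suc; _+_; _*_; _^_; _∸_; _<_; _≤_; _≥_; z≤n; s≤s; NonZero)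
import Data.Nat.Properties as ℕP
open import Data.Nat.ListAction using (sum; product)
open import Data.Nat.ListAction.Properties using (sum-++; product-++)
open import Data.Nat.Solver using (module +-*-Solver)
open import Data.Integer as ℤ using (ℤ; +_; -[1+_]; +≤+)
import Data.Integer.Properties as ℤP
open import Data.Rational as ℚ using (ℚ; _/_; toℚᵘ)
import Data.Rational.Properties as ℚP
open import Data.Rational.Unnormalised using (mkℚᵘ; *≡*) renaming (_≃_ to _≃ᵘ_)
import Data.Rational.Unnormalised.Properties as ℚᵘP
open import Data.List
  using (List; []; _∷_; _++_; map; length; filter; upTo; applyUpTo; concatMap; cartesianProduct)
open import Data.List.Properties
  using ( map-++; map-∘; map-cong; map-upTo; map-applyUpTo; map-concatMap; concatMap-cong
        ; length-++; length-map; length-upTo; applyUpTo-∷ʳ)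
open import Data.List.Membership.Propositional using (_∈_; _∉_; find; lose)
open import Data.List.Membership.Propositional.Properties
  using ( ∈-++⁺ˡ; ∈-++⁺ʳ; ∈-++⁻; ∈-map⁺; ∈-map⁻; ∈-upTo⁺; ∈-upTo⁻; ∈-concatMap⁺; ∈-concatMap⁻
        ; ∈-cartesianProduct⁺; ∈-cartesianProduct⁻)
open import Data.List.Membership.Propositional.Properties.WithK using (unique∧set⇒bag)
import Data.List.Membership.DecPropositional as DecMembership
open import Data.List.Relation.Binary.BagAndSetEquality using (∼bag⇒↭)
open import Data.List.Relation.Binary.Subset.Propositional using (_⊆_)
import Data.List.Relation.Binary.Subset.Propositional.Properties as ⊆
import Data.List.Relation.Binary.Subset.DecPropositional as DecSubset
open import Data.List.Relation.Binary.Disjoint.Propositional using (Disjoint)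
open import Data.List.Relation.Binary.Permutation.Propositional as Perm using (_↭_; ↭-sym)
import Data.List.Relation.Binary.Permutation.Propositional.Properties as ↭
open import Data.List.Relation.Unary.Any using (here; there)
open import Data.List.Relation.Unary.All as All using (All)
import Data.List.Relation.Unary.All.Properties as All
open import Data.List.Relation.Unary.AllPairs using ([]; _∷_)
open import Data.List.Relation.Unary.Unique.Propositional using (Unique)
import Data.List.Relation.Unary.Unique.Propositional.Properties as Unique
open import Data.Product using (_×_; _,_; proj₁; proj₂; ∃-syntax)
open import Data.Product.Properties using (≡-dec; ,-injectiveˡ; ,-injectiveʳ)
open import Data.Sum using (_⊎_; inj₁; inj₂)
open import Data.Empty using (⊥-elim)
import Algebra.Properties.CommutativeSemigroup ℕP.+-commutativeSemigroup as +-CS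
open import Function using (_∘_; _⇔_; Equivalence; mk⇔; case_of_)
open import Relation.Binary.Construct.Closure.ReflexiveTransitive using (ε; _◅_)
open import Relation.Binary.Definitions using (DecidableEquality; _Respects_)
open import Relation.Binary.PropositionalEquality
open import Relation.Nullary using (Dec; yes; no; ¬_; ¬?)
open import Relation.Nullary.Decidable using (_×-dec_)
open import Relation.Unary using (Decidable)
open import Relation.Unary.Properties using (_∩?_; ∁?)
open +-*-Solver using (solve; _:=_; _:+_; _:*_; _:^_; con)

-- Sums over lists and over sublists

private variable
  A B K : Set

∑[_]_ : List A → (A → ℕ) → ℕ
∑[ xs ] f = sum (map f xs)

∑-++ : ∀ (xs ys : List A) f → ∑[ xs ++ ys ] f ≡ ∑[ xs ] f + ∑[ ys ] f
∑-++ xs ys f = trans (cong sum (map-++ f xs ys)) (sum-++ (map f xs) (map f ys))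

∑-map : ∀ (g : A → B) xs f → ∑[ map g xs ] f ≡ ∑[ xs ] (f ∘ g)
∑-map g xs f = cong sum (sym (map-∘ xs))

∑-cong : ∀ (xs : List A) {f g} → (∀ {x} → x ∈ xs → f x ≡ g x) → ∑[ xs ] f ≡ ∑[ xs ] g
∑-cong []       f≡g = refl
∑-cong (x ∷ xs) f≡g = cong₂ _+_ (f≡g (here refl)) (∑-cong xs (f≡g ∘ there))

∑-zero : ∀ (xs : List A) {f} → (∀ {x} → x ∈ xs → f x ≡ 0) → ∑[ xs ] f ≡ 0
∑-zero []       f≡0 = refl
∑-zero (x ∷ xs) f≡0 = cong₂ _+_ (f≡0 (here refl)) (∑-zero xs (f≡0 ∘ there))

∑-*ˡ : ∀ (xs : List A) c f → ∑[ xs ] (λ x → c * f x) ≡ c * ∑[ xs ] f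
∑-*ˡ []       c f = sym (ℕP.*-zeroʳ c)
∑-*ˡ (x ∷ xs) c f =
  trans (cong (_+_ (c * f x)) (∑-*ˡ xs c f)) (sym (ℕP.*-distribˡ-+ c (f x) _))

∑-*ʳ : ∀ (xs : List A) c f → ∑[ xs ] (λ x → f x * c) ≡ ∑[ xs ] f * c
∑-*ʳ []       c f = refl
∑-*ʳ (x ∷ xs) c f =
  trans (cong (_+_ (f x * c)) (∑-*ʳ xs c f)) (sym (ℕP.*-distribʳ-+ c (f x) _))

∑-+ : ∀ (xs : List A) f g → ∑[ xs ] (λ x → f x + g x) ≡ ∑[ xs ] f + ∑[ xs ] g
∑-+ []       f g = refl
∑-+ (x ∷ xs) f g =
  trans (cong (_+_ (f x + g x)) (∑-+ xs f g)) (+-CS.interchange (f x) (g x) _ _)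

indicator : {P : Set} → Dec P → ℕ → ℕ
indicator (yes _) k = k
indicator (no _)  k = 0

indicator-yes : {P : Set} (P? : Dec P) → P → ∀ k → indicator P? k ≡ k
indicator-yes (yes _) _ k = refl
indicator-yes (no ¬p) p k = ⊥-elim (¬p p)

indicator-no : {P : Set} (P? : Dec P) → ¬ P → ∀ k → indicator P? k ≡ 0
indicator-no (yes p) ¬p k = ⊥-elim (¬p p)
indicator-no (no _)  _  k = refl

indicator-cong : {P Q : Set} (P? : Dec P) (Q? : Dec Q) → P ⇔ Q → ∀ k →
                 indicator P? k ≡ indicator Q? k
indicator-cong (yes _) (yes _) P⇔Q k = refl
indicator-cong (yes p) (no ¬q) P⇔Q k = ⊥-elim (¬q (Equivalence.to P⇔Q p))
indicator-cong (no ¬p) (yes q) P⇔Q k = ⊥-elim (¬p (Equivalence.from P⇔Q q))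
indicator-cong (no _)  (no _)  P⇔Q k = refl

indicator-split : {P R : Set} (P? : Dec P) (R? : Dec R) → ∀ k →
                  indicator P? k ≡ indicator (P? ×-dec R?) k + indicator (P? ×-dec ¬? R?) k
indicator-split (yes _) (yes _) k = sym (ℕP.+-identityʳ k)
indicator-split (yes _) (no _)  k = refl
indicator-split (no _)  R?      k = refl

indicator-*ˡ : {P : Set} (P? : Dec P) → ∀ c k → indicator P? (c * k) ≡ c * indicator P? k
indicator-*ˡ (yes _) c k = refl
indicator-*ˡ (no _)  c k = sym (ℕP.*-zeroʳ c)

indicator-× : {P Q : Set} (P? : Dec P) (Q? : Dec Q) {R : Set} (R? : Dec R) → R ⇔ (P × Q) →
              ∀ k l → indicator R? (k * l) ≡ indicator P? k * indicator Q? l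
indicator-× (yes p) (yes q) R? R⇔P×Q k l = indicator-yes R? (Equivalence.from R⇔P×Q (p , q)) _
indicator-× (yes _) (no ¬q) R? R⇔P×Q k l =
  trans (indicator-no R? (¬q ∘ proj₂ ∘ Equivalence.to R⇔P×Q) _) (sym (ℕP.*-zeroʳ k))
indicator-× (no ¬p) Q? R? R⇔P×Q k l = indicator-no R? (¬p ∘ proj₁ ∘ Equivalence.to R⇔P×Q) _

∑-filter : ∀ {P : A → Set} (P? : Decidable P) f xs →
           sum (map f (filter P? xs)) ≡ ∑[ xs ] (λ x → indicator (P? x) (f x))
∑-filter P? f []       = refl
∑-filter P? f (x ∷ xs) with P? x
... | yes _ = cong (_+_ (f x)) (∑-filter P? f xs)
... | no  _ = ∑-filter P? f xs

∈-subsets⇒⊆ : ∀ {xs I : List A} → I ∈ subsets xs → I ⊆ xs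
∈-subsets⇒⊆ {xs = []}     (here refl) ()
∈-subsets⇒⊆ {xs = x ∷ xs} I∈ z∈I with ∈-++⁻ (subsets xs) I∈
... | inj₁ I∈′ = there (∈-subsets⇒⊆ I∈′ z∈I)
... | inj₂ I∈′ with ∈-map⁻ (x ∷_) I∈′
...   | I′ , I′∈ , refl with z∈I
...     | here z≡x  = here z≡x
...     | there z∈′ = there (∈-subsets⇒⊆ I′∈ z∈′)

∈-subsets-++⇒⊆ : ∀ (xs ys : List A) {I J} → I ∈ subsets xs → J ∈ subsets ys → I ++ J ⊆ xs ++ ys
∈-subsets-++⇒⊆ xs ys I∈ J∈ = ⊆.++⁺ {xs = xs} {zs = ys} (∈-subsets⇒⊆ I∈) (∈-subsets⇒⊆ J∈)

∑-subsets-∷ : ∀ x (xs : List A) g →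
              ∑[ subsets (x ∷ xs) ] g ≡ ∑[ subsets xs ] g + ∑[ subsets xs ] (g ∘ (x ∷_))
∑-subsets-∷ x xs g =
  trans (∑-++ (subsets xs) _ g) (cong (_+_ (∑[ subsets xs ] g)) (∑-map (x ∷_) (subsets xs) g))

∑-subsets-++ : ∀ (xs ys : List A) g →
  ∑[ subsets (xs ++ ys) ] g ≡ ∑[ subsets xs ] (λ I → ∑[ subsets ys ] (λ J → g (I ++ J)))
∑-subsets-++ []       ys g = sym (ℕP.+-identityʳ _)
∑-subsets-++ (x ∷ xs) ys g = begin
  ∑[ subsets (x ∷ xs ++ ys) ] g
    ≡⟨ ∑-subsets-∷ x (xs ++ ys) g ⟩
  ∑[ subsets (xs ++ ys) ] g + ∑[ subsets (xs ++ ys) ] (g ∘ (x ∷_))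
    ≡⟨ cong₂ _+_ (∑-subsets-++ xs ys g) (∑-subsets-++ xs ys (g ∘ (x ∷_))) ⟩
  ∑[ subsets xs ] h + ∑[ subsets xs ] (h ∘ (x ∷_))
    ≡⟨ ∑-subsets-∷ x xs h ⟨
  ∑[ subsets (x ∷ xs) ] h ∎
  where
  open ≡-Reasoning
  h = λ I → ∑[ subsets ys ] (λ J → g (I ++ J))

subsets-map : ∀ (f : A → B) xs → subsets (map f xs) ≡ map (map f) (subsets xs)
subsets-map f []       = refl
subsets-map f (x ∷ xs) = begin
  subsets (map f xs) ++ map (f x ∷_) (subsets (map f xs))
    ≡⟨ cong (λ L → L ++ map (f x ∷_) L) (subsets-map f xs) ⟩
  map (map f) (subsets xs) ++ map (f x ∷_) (map (map f) (subsets xs))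
    ≡⟨ cong (map (map f) (subsets xs) ++_) (trans (sym (map-∘ (subsets xs))) (map-∘ (subsets xs))) ⟨
  map (map f) (subsets xs) ++ map (map f) (map (x ∷_) (subsets xs))
    ≡⟨ map-++ (map f) (subsets xs) _ ⟨
  map (map f) (subsets (x ∷ xs)) ∎
  where open ≡-Reasoning

∑-subsets-map : ∀ (f : A → B) xs g → ∑[ subsets (map f xs) ] g ≡ ∑[ subsets xs ] (g ∘ map f)
∑-subsets-map f xs g =
  trans (cong (λ L → ∑[ L ] g) (subsets-map f xs)) (∑-map (map f) (subsets xs) g)

∑-subsets-↭ : ∀ {xs ys : List A} (g : List A → ℕ) → (∀ {I J} → I ↭ J → g I ≡ g J) →
              xs ↭ ys → ∑[ subsets xs ] g ≡ ∑[ subsets ys ] g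
∑-subsets-↭ g g-↭ Perm.refl             = refl
∑-subsets-↭ g g-↭ (Perm.trans xs↭ ↭ys) = trans (∑-subsets-↭ g g-↭ xs↭) (∑-subsets-↭ g g-↭ ↭ys)
∑-subsets-↭ {xs = x ∷ xs} {x ∷ ys} g g-↭ (Perm.prep x xs↭ys) = begin
  ∑[ subsets (x ∷ xs) ] g
    ≡⟨ ∑-subsets-∷ x xs g ⟩
  ∑[ subsets xs ] g + ∑[ subsets xs ] (g ∘ (x ∷_))
    ≡⟨ cong₂ _+_ (∑-subsets-↭ g g-↭ xs↭ys) (∑-subsets-↭ (g ∘ (x ∷_)) (g-↭ ∘ Perm.prep x) xs↭ys) ⟩
  ∑[ subsets ys ] g + ∑[ subsets ys ] (g ∘ (x ∷_))
    ≡⟨ ∑-subsets-∷ x ys g ⟨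
  ∑[ subsets (x ∷ ys) ] g ∎
  where open ≡-Reasoning
∑-subsets-↭ {xs = x ∷ y ∷ xs} {y ∷ x ∷ ys} g g-↭ (Perm.swap x y xs↭ys) = begin
  ∑[ subsets (x ∷ y ∷ xs) ] g
    ≡⟨ expand x y xs ⟩
  (∑[ subsets xs ] g + ∑[ subsets xs ] (g ∘ (y ∷_))) +
  (∑[ subsets xs ] (g ∘ (x ∷_)) + ∑[ subsets xs ] (g ∘ (λ I → x ∷ y ∷ I)))
    ≡⟨ cong₂ _+_ (cong₂ _+_ (rec g g-↭) (rec (g ∘ (y ∷_)) (g-↭ ∘ Perm.prep y)))
                 (cong₂ _+_ (rec (g ∘ (x ∷_)) (g-↭ ∘ Perm.prep x))
                            (trans (∑-cong (subsets xs) (λ _ → g-↭ (Perm.swap x y Perm.refl)))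
                                   (rec (g ∘ (λ I → y ∷ x ∷ I)) (g-↭ ∘ Perm.prep y ∘ Perm.prep x)))) ⟩
  (∑[ subsets ys ] g + ∑[ subsets ys ] (g ∘ (y ∷_))) +
  (∑[ subsets ys ] (g ∘ (x ∷_)) + ∑[ subsets ys ] (g ∘ (λ I → y ∷ x ∷ I)))
    ≡⟨ +-CS.interchange (∑[ subsets ys ] g) _ _ _ ⟩
  (∑[ subsets ys ] g + ∑[ subsets ys ] (g ∘ (x ∷_))) +
  (∑[ subsets ys ] (g ∘ (y ∷_)) + ∑[ subsets ys ] (g ∘ (λ I → y ∷ x ∷ I)))
    ≡⟨ expand y x ys ⟨
  ∑[ subsets (y ∷ x ∷ ys) ] g ∎
  where
  open ≡-Reasoning
  rec : (h : List _ → ℕ) → (∀ {I J} → I ↭ J → h I ≡ h J) → ∑[ subsets xs ] h ≡ ∑[ subsets ys ] h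
  rec h h-↭ = ∑-subsets-↭ h h-↭ xs↭ys
  expand : ∀ u v zs → ∑[ subsets (u ∷ v ∷ zs) ] g ≡
    (∑[ subsets zs ] g + ∑[ subsets zs ] (g ∘ (v ∷_))) +
    (∑[ subsets zs ] (g ∘ (u ∷_)) + ∑[ subsets zs ] (g ∘ (λ I → u ∷ v ∷ I)))
  expand u v zs = trans (∑-subsets-∷ u (v ∷ zs) g)
    (cong₂ _+_ (∑-subsets-∷ v zs g) (∑-subsets-∷ v zs (g ∘ (u ∷_))))

∑-subsets-only-[] : ∀ (xs : List A) g → (∀ {I z} → I ∈ subsets xs → z ∈ I → g I ≡ 0) →
                    ∑[ subsets xs ] g ≡ g []
∑-subsets-only-[] []       g g≡0 = ℕP.+-identityʳ _
∑-subsets-only-[] (x ∷ xs) g g≡0 = begin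
  ∑[ subsets (x ∷ xs) ] g
    ≡⟨ ∑-subsets-∷ x xs g ⟩
  ∑[ subsets xs ] g + ∑[ subsets xs ] (g ∘ (x ∷_))
    ≡⟨ cong₂ _+_ (∑-subsets-only-[] xs g (g≡0 ∘ ∈-++⁺ˡ))
                 (∑-zero (subsets xs) (λ I∈ → g≡0 (∈-++⁺ʳ (subsets xs) (∈-map⁺ (x ∷_) I∈)) (here refl))) ⟩
  g [] + 0
    ≡⟨ ℕP.+-identityʳ _ ⟩
  g [] ∎
  where open ≡-Reasoning

∑-subsets-only-full : ∀ (xs : List A) g → Unique xs →
                      (∀ {I z} → I ∈ subsets xs → z ∈ xs → z ∉ I → g I ≡ 0) →
                      ∑[ subsets xs ] g ≡ g xs
∑-subsets-only-full []       g _            g≡0 = ℕP.+-identityʳ _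
∑-subsets-only-full (x ∷ xs) g !x∷xs@(_ ∷ !xs) g≡0 = begin
  ∑[ subsets (x ∷ xs) ] g
    ≡⟨ ∑-subsets-∷ x xs g ⟩
  ∑[ subsets xs ] g + ∑[ subsets xs ] (g ∘ (x ∷_))
    ≡⟨ cong₂ _+_ (∑-zero (subsets xs) (λ I∈ → g≡0 (∈-++⁺ˡ I∈) (here refl) (x∉I I∈)))
                 (∑-subsets-only-full xs (g ∘ (x ∷_)) !xs
                    (λ I∈ z∈ z∉ → g≡0 (∷-∈ I∈) (there z∈) (∷-∉ z∈ z∉))) ⟩
  0 + g (x ∷ xs) ∎
  where
  open ≡-Reasoning
  x∉xs : x ∉ xs
  x∉xs = Unique.Unique[x∷xs]⇒x∉xs !x∷xs
  x∉I : ∀ {I} → I ∈ subsets xs → x ∉ I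
  x∉I I∈ = x∉xs ∘ ∈-subsets⇒⊆ I∈
  ∷-∈ : ∀ {I} → I ∈ subsets xs → x ∷ I ∈ subsets (x ∷ xs)
  ∷-∈ I∈ = ∈-++⁺ʳ (subsets xs) (∈-map⁺ (x ∷_) I∈)
  ∷-∉ : ∀ {I z} → z ∈ xs → z ∉ I → z ∉ x ∷ I
  ∷-∉ z∈ z∉ (here refl) = x∉xs z∈
  ∷-∉ z∈ z∉ (there z∈I) = z∉ z∈I

↭-from-∈ : ∀ {xs ys : List A} → Unique xs → Unique ys → (∀ {z} → z ∈ xs ⇔ z ∈ ys) → xs ↭ ys
↭-from-∈ !xs !ys xs⇔ys = ∼bag⇒↭ (unique∧set⇒bag !xs !ys xs⇔ys)

concatMap-unique : ∀ (f : A → List B) {xs} → Unique xs → (∀ x → Unique (f x)) →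
                   (∀ {x y z} → z ∈ f x → z ∈ f y → x ≡ y) → Unique (concatMap f xs)
concatMap-unique f {[]}     _               !f f-disjoint = []
concatMap-unique f {x ∷ xs} !x∷xs@(_ ∷ !xs) !f f-disjoint =
  Unique.++⁺ (!f x) (concatMap-unique f !xs !f f-disjoint) λ (z∈fx , z∈rest) →
    let y , y∈xs , z∈fy = find (∈-concatMap⁻ f {xs = xs} z∈rest)
    in Unique.Unique[x∷xs]⇒x∉xs !x∷xs (subst (_∈ xs) (sym (f-disjoint z∈fx z∈fy)) y∈xs)

-- Size generating functions of families of sublists

weight : {P : List A → Set} → Decidable P → ℕ → List A → ℕ
weight P? q I = indicator (P? I) (q ^ length I)

weight-++ : ∀ {P : List A → Set} (P? : Decidable P) q I J →
            weight P? q (I ++ J) ≡ indicator (P? (I ++ J)) (q ^ length I * q ^ length J)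
weight-++ P? q I J = cong (indicator (P? (I ++ J)))
  (trans (cong (q ^_) (length-++ I)) (ℕP.^-distribˡ-+-* q (length I) _))

GF : {P : List A → Set} → Decidable P → List A → ℕ → ℕ
GF P? U q = ∑[ subsets U ] (weight P? q)

module _ {P : List A → Set} (P? : Decidable P) (q : ℕ) where

  GF-map : ∀ (f : B → A) U → GF P? (map f U) q ≡ GF (P? ∘ map f) U q
  GF-map f U = trans (∑-subsets-map f U _)
    (∑-cong (subsets U) (λ {I} _ → cong (λ k → indicator (P? (map f I)) (q ^ k)) (length-map f I)))

  GF-cong : ∀ {Q : List A → Set} (Q? : Decidable Q) U → (∀ {I} → I ⊆ U → P I ⇔ Q I) →
            GF P? U q ≡ GF Q? U q
  GF-cong Q? U P⇔Q = ∑-cong (subsets U) λ {I} I∈ →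
    indicator-cong (P? I) (Q? I) (P⇔Q (∈-subsets⇒⊆ I∈)) _

  GF-↭ : P Respects _↭_ → ∀ {U V} → U ↭ V → GF P? U q ≡ GF P? V q
  GF-↭ P-resp = ∑-subsets-↭ _ λ {I} {J} I↭J →
    trans (indicator-cong (P? I) (P? J) (mk⇔ (P-resp I↭J) (P-resp (Perm.↭-sym I↭J))) _)
          (cong (λ k → indicator (P? J) (q ^ k)) (↭.↭-length I↭J))

  GF-split : ∀ {R : List A → Set} (R? : Decidable R) U →
             GF P? U q ≡ GF (P? ∩? R?) U q + GF (P? ∩? ∁? R?) U q
  GF-split R? U = trans (∑-cong (subsets U) λ {I} _ → indicator-split (P? I) (R? I) _)
                        (∑-+ (subsets U) _ _)

  GF-avoid : ∀ W V → (∀ {I} → I ⊆ W ++ V → P I → ∀ {z} → z ∈ W → z ∉ I) →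
             GF P? (W ++ V) q ≡ GF P? V q
  GF-avoid W V avoids = trans (∑-subsets-++ W V _) (∑-subsets-only-[] W _ λ {J} {z} J∈ z∈J →
    ∑-zero (subsets V) λ {I} I∈ → indicator-no (P? (J ++ I))
      (λ p → avoids (∈-subsets-++⇒⊆ W V J∈ I∈) p (∈-subsets⇒⊆ J∈ z∈J) (∈-++⁺ˡ z∈J)) _)

  GF-forced : ∀ W V → Unique W → Disjoint W V → (∀ {I} → I ⊆ W ++ V → P I → W ⊆ I) →
              GF P? (W ++ V) q ≡ q ^ length W * GF (P? ∘ (W ++_)) V q
  GF-forced W V !W W#V forced = begin
    GF P? (W ++ V) q
      ≡⟨ ∑-subsets-++ W V _ ⟩
    ∑[ subsets W ] (λ J → ∑[ subsets V ] (λ I → weight P? q (J ++ I)))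
      ≡⟨ ∑-subsets-only-full W _ !W (λ J∈ z∈W z∉J → ∑-zero (subsets V) λ I∈ → missing J∈ I∈ z∈W z∉J) ⟩
    ∑[ subsets V ] (λ I → weight P? q (W ++ I))
      ≡⟨ ∑-cong (subsets V) (λ {I} _ →
           trans (weight-++ P? q W I) (indicator-*ˡ (P? (W ++ I)) (q ^ length W) _)) ⟩
    ∑[ subsets V ] (λ I → q ^ length W * indicator (P? (W ++ I)) (q ^ length I))
      ≡⟨ ∑-*ˡ (subsets V) (q ^ length W) _ ⟩
    q ^ length W * GF (P? ∘ (W ++_)) V q ∎
    where
    open ≡-Reasoning
    missing : ∀ {J I z} → J ∈ subsets W → I ∈ subsets V → z ∈ W → z ∉ J →
              weight P? q (J ++ I) ≡ 0
    missing {J} {I} J∈ I∈ z∈W z∉J = indicator-no (P? (J ++ I)) (λ p →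
      case ∈-++⁻ J (forced (∈-subsets-++⇒⊆ W V J∈ I∈) p z∈W) of λ where
        (inj₁ z∈J) → z∉J z∈J
        (inj₂ z∈I) → W#V (z∈W , ∈-subsets⇒⊆ I∈ z∈I)) _

  GF-concatMap : ∀ (R : K → List A) → P [] →
    (∀ {k ks I J} → k ∉ ks → I ⊆ R k → J ⊆ concatMap R ks → P (I ++ J) ⇔ (P I × P J)) →
    ∀ ks → Unique ks → GF P? (concatMap R ks) q ≡ product (map (λ k → GF P? (R k) q) ks)
  GF-concatMap R P[] splits []       _     = trans (ℕP.+-identityʳ _) (indicator-yes (P? []) P[] 1)
  GF-concatMap R P[] splits (k ∷ ks) !k∷ks@(_ ∷ !ks) = begin
    GF P? (R k ++ concatMap R ks) q
      ≡⟨ ∑-subsets-++ (R k) (concatMap R ks) _ ⟩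
    ∑[ subsets (R k) ] (λ I → ∑[ subsets (concatMap R ks) ] (λ J → w (I ++ J)))
      ≡⟨ ∑-cong (subsets (R k)) (λ {I} I∈ → trans (∑-cong (subsets (concatMap R ks)) (w-++ I∈))
                                              (∑-*ˡ (subsets (concatMap R ks)) (w I) w)) ⟩
    ∑[ subsets (R k) ] (λ I → w I * GF P? (concatMap R ks) q)
      ≡⟨ ∑-*ʳ (subsets (R k)) (GF P? (concatMap R ks) q) w ⟩
    GF P? (R k) q * GF P? (concatMap R ks) q
      ≡⟨ cong (GF P? (R k) q *_) (GF-concatMap R P[] splits ks !ks) ⟩
    GF P? (R k) q * product (map (λ k → GF P? (R k) q) ks) ∎
    where
    open ≡-Reasoning
    w = weight P? q
    w-++ : ∀ {I J} → I ∈ subsets (R k) → J ∈ subsets (concatMap R ks) → w (I ++ J) ≡ w I * w J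
    w-++ {I} {J} I∈ J∈ = trans (weight-++ P? q I J) (indicator-× (P? I) (P? J) (P? (I ++ J))
      (splits (Unique.Unique[x∷xs]⇒x∉xs !k∷ks) (∈-subsets⇒⊆ I∈) (∈-subsets⇒⊆ J∈)) _ _)

-- Down-closed sublists

DownClosed : (A → List A) → List A → Set
DownClosed below I = All (λ t → below t ⊆ I) I

downClosed? : DecidableEquality A → (below : A → List A) → Decidable (DownClosed below)
downClosed? _≟_ below I = All.all? (λ t → below t ⊆? I) I
  where open DecSubset _≟_ using (_⊆?_)

module _ {below : A → List A} where

  DownClosed-resp-↭ : DownClosed below Respects _↭_
  DownClosed-resp-↭ I↭J closed =
    ↭.All-resp-↭ I↭J (All.map (λ below⊆I {p} p∈ → ↭.∈-resp-↭ I↭J (below⊆I p∈)) closed)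

  DownClosed-++ : ∀ {I J} → (∀ {t p} → t ∈ I → p ∈ below t → p ∉ J) →
                  (∀ {t p} → t ∈ J → p ∈ below t → p ∉ I) →
                  DownClosed below (I ++ J) ⇔ (DownClosed below I × DownClosed below J)
  DownClosed-++ {I} {J} I↛J J↛I = mk⇔
    (λ closed → let closedI , closedJ = All.++⁻ I closed in
        All.tabulate (λ t∈ {p} p∈ → stay-left t∈ p∈ (All.lookup closedI t∈ p∈))
      , All.tabulate (λ t∈ {p} p∈ → stay-right t∈ p∈ (All.lookup closedJ t∈ p∈)))
    (λ (closedI , closedJ) → All.++⁺ (All.map (λ b⊆I {p} p∈ → ∈-++⁺ˡ (b⊆I p∈)) closedI)
                                      (All.map (λ b⊆J {p} p∈ → ∈-++⁺ʳ I (b⊆J p∈)) closedJ))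
    where
    stay-left : ∀ {t p} → t ∈ I → p ∈ below t → p ∈ I ++ J → p ∈ I
    stay-left t∈ p∈ p∈I++J with ∈-++⁻ I p∈I++J
    ... | inj₁ p∈I = p∈I
    ... | inj₂ p∈J = ⊥-elim (I↛J t∈ p∈ p∈J)
    stay-right : ∀ {t p} → t ∈ J → p ∈ below t → p ∈ I ++ J → p ∈ J
    stay-right t∈ p∈ p∈I++J with ∈-++⁻ I p∈I++J
    ... | inj₁ p∈I = ⊥-elim (J↛I t∈ p∈ p∈I)
    ... | inj₂ p∈J = p∈J

DownClosed-map : ∀ {below : A → List A} {below′ : B → List B} (f : A → B) {U} →
  (∀ {x y} → f x ≡ f y → x ≡ y) →
  (∀ {t p} → t ∈ U → p ∈ below′ (f t) ⇔ p ∈ map f (below t)) →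
  ∀ {I} → I ⊆ U → DownClosed below′ (map f I) ⇔ DownClosed below I
DownClosed-map {below = below} {below′} f f-inj covers {I} I⊆U = mk⇔
  (λ closed → All.tabulate λ {t} t∈ {p} p∈ →
     let fp∈ = All.lookup closed (∈-map⁺ f t∈) (Equivalence.from (covers (I⊆U t∈)) (∈-map⁺ f p∈))
         p′ , p′∈ , fp≡fp′ = ∈-map⁻ f fp∈
     in subst (_∈ I) (sym (f-inj fp≡fp′)) p′∈)
  (λ closed → All.map⁺ (All.tabulate λ {t} t∈ {p} p∈ →
     let p′ , p′∈ , p≡fp′ = ∈-map⁻ f (Equivalence.to (covers (I⊆U t∈)) p∈)
     in subst (_∈ map f I) (sym p≡fp′) (∈-map⁺ f (All.lookup closed t∈ p′∈))))

-- Order ideals of a rectangle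

_≟₂_ : DecidableEquality (ℕ × ℕ)
_≟₂_ = ≡-dec ℕ._≟_ ℕ._≟_

open DecMembership _≟₂_ using (_∈?_)

data _⋖₂_ : ℕ × ℕ → ℕ × ℕ → Set where
  step-i : ∀ {i j} → (i , j) ⋖₂ (suc i , j)
  step-j : ∀ {i j} → (i , j) ⋖₂ (i , suc j)

below₂ : ℕ × ℕ → List (ℕ × ℕ)
below₂ (zero  , zero)  = []
below₂ (suc i , zero)  = (i , zero) ∷ []
below₂ (zero  , suc j) = (zero , j) ∷ []
below₂ (suc i , suc j) = (i , suc j) ∷ (suc i , j) ∷ []

∈-below₂⁺ : ∀ {p t} → p ⋖₂ t → p ∈ below₂ t
∈-below₂⁺ {t = suc i , zero}  step-i = here refl
∈-below₂⁺ {t = suc i , suc j} step-i = here refl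
∈-below₂⁺ {t = zero , suc j}  step-j = here refl
∈-below₂⁺ {t = suc i , suc j} step-j = there (here refl)

∈-below₂⁻ : ∀ {p t} → p ∈ below₂ t → p ⋖₂ t
∈-below₂⁻ {t = suc i , zero}  (here refl)         = step-i
∈-below₂⁻ {t = zero , suc j}  (here refl)         = step-j
∈-below₂⁻ {t = suc i , suc j} (here refl)         = step-i
∈-below₂⁻ {t = suc i , suc j} (there (here refl)) = step-j

Ideal₂ : List (ℕ × ℕ) → Set
Ideal₂ = DownClosed below₂

ideal₂? : Decidable Ideal₂
ideal₂? = downClosed? _≟₂_ below₂

rectangle : ℕ → ℕ → List (ℕ × ℕ)
rectangle a b = cartesianProduct (upTo a) (upTo b)

∈-rectangle⁺ : ∀ {a b i j} → i < a → j < b → (i , j) ∈ rectangle a b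
∈-rectangle⁺ i<a j<b = ∈-cartesianProduct⁺ (∈-upTo⁺ i<a) (∈-upTo⁺ j<b)

∈-rectangle⁻ : ∀ a b {i j} → (i , j) ∈ rectangle a b → i < a × j < b
∈-rectangle⁻ a b ij∈ =
  let i∈ , j∈ = ∈-cartesianProduct⁻ (upTo a) (upTo b) ij∈ in ∈-upTo⁻ i∈ , ∈-upTo⁻ j∈

rectangle-unique : ∀ a b → Unique (rectangle a b)
rectangle-unique a b = Unique.cartesianProduct⁺ (Unique.upTo⁺ a) (Unique.upTo⁺ b)

rectangle-zeroʳ : ∀ a → rectangle a 0 ≡ []
rectangle-zeroʳ a = ⊆.⊆[]⇒≡[] λ { {i , j} ij∈ → case proj₂ (∈-rectangle⁻ a 0 ij∈) of λ () }

row : ℕ → ℕ → List (ℕ × ℕ)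
row a b = map (a ,_) (upTo b)

column : ℕ → List (ℕ × ℕ)
column a = map (_, 0) (upTo (suc a))

shift : ℕ × ℕ → ℕ × ℕ
shift (i , j) = (i , suc j)

shift-injective : ∀ {p p′} → shift p ≡ shift p′ → p ≡ p′
shift-injective refl = refl

∈-row⁻ : ∀ {a b p} → p ∈ row a b → proj₁ p ≡ a
∈-row⁻ p∈ with ∈-map⁻ _ p∈
... | _ , _ , refl = refl

∈-column⁻ : ∀ {a i j} → (i , j) ∈ column a → i ≤ a × j ≡ 0
∈-column⁻ ij∈ with ∈-map⁻ _ ij∈
... | _ , i∈ , refl = ℕP.≤-pred (∈-upTo⁻ i∈) , refl

∈-column⁺ : ∀ {a i} → i ≤ a → (i , 0) ∈ column a
∈-column⁺ i≤a = ∈-map⁺ _ (∈-upTo⁺ (s≤s i≤a))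

∈-shift⁻ : ∀ {I i j} → (i , j) ∈ map shift I → ∃[ j′ ] (j ≡ suc j′ × (i , j′) ∈ I)
∈-shift⁻ ij∈ with ∈-map⁻ shift ij∈
... | (_ , j′) , ij′∈ , refl = j′ , refl , ij′∈

rectangle-↭-row : ∀ a b → rectangle (suc a) b ↭ row a b ++ rectangle a b
rectangle-↭-row a b = ↭-from-∈ (rectangle-unique (suc a) b)
  (Unique.++⁺ (Unique.map⁺ ,-injectiveʳ (Unique.upTo⁺ b)) (rectangle-unique a b) disjoint)
  (mk⇔ to from)
  where
  disjoint : Disjoint (row a b) (rectangle a b)
  disjoint (p∈row , p∈rect) with ∈-row⁻ p∈row
  ... | refl = ℕP.<-irrefl refl (proj₁ (∈-rectangle⁻ a b p∈rect))
  to : ∀ {p} → p ∈ rectangle (suc a) b → p ∈ row a b ++ rectangle a b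
  to {i , j} ij∈ with ∈-rectangle⁻ (suc a) b ij∈
  ... | i<1+a , j<b with ℕP.m≤n⇒m<n∨m≡n (ℕP.≤-pred i<1+a)
  ...   | inj₁ i<a  = ∈-++⁺ʳ (row a b) (∈-rectangle⁺ i<a j<b)
  ...   | inj₂ refl = ∈-++⁺ˡ (∈-map⁺ (a ,_) (∈-upTo⁺ j<b))
  from : ∀ {p} → p ∈ row a b ++ rectangle a b → p ∈ rectangle (suc a) b
  from {i , j} ij∈ with ∈-++⁻ (row a b) ij∈
  ... | inj₂ ij∈rect = let i<a , j<b = ∈-rectangle⁻ a b ij∈rect in ∈-rectangle⁺ (ℕP.m<n⇒m<1+n i<a) j<b
  ... | inj₁ ij∈row with ∈-map⁻ (a ,_) ij∈row
  ...   | _ , j∈ , refl = ∈-rectangle⁺ ℕP.≤-refl (∈-upTo⁻ j∈)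

column#shift : ∀ a I → Disjoint (column a) (map shift I)
column#shift a I {i , j} (ij∈col , ij∈sh) with ∈-column⁻ ij∈col | ∈-shift⁻ {I} ij∈sh
... | _ , refl | _ , () , _

rectangle-↭-column : ∀ a b → rectangle (suc a) (suc b) ↭ column a ++ map shift (rectangle (suc a) b)
rectangle-↭-column a b = ↭-from-∈ (rectangle-unique (suc a) (suc b))
  (Unique.++⁺ (Unique.map⁺ ,-injectiveˡ (Unique.upTo⁺ (suc a)))
              (Unique.map⁺ shift-injective (rectangle-unique (suc a) b)) (column#shift a _))
  (mk⇔ to from)
  where
  to : ∀ {p} → p ∈ rectangle (suc a) (suc b) → p ∈ column a ++ map shift (rectangle (suc a) b)
  to {i , zero}  ij∈ = ∈-++⁺ˡ (∈-column⁺ (ℕP.≤-pred (proj₁ (∈-rectangle⁻ (suc a) (suc b) ij∈))))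
  to {i , suc j} ij∈ = let i< , j< = ∈-rectangle⁻ (suc a) (suc b) ij∈ in
    ∈-++⁺ʳ (column a) (∈-map⁺ shift (∈-rectangle⁺ i< (ℕP.≤-pred j<)))
  from : ∀ {p} → p ∈ column a ++ map shift (rectangle (suc a) b) → p ∈ rectangle (suc a) (suc b)
  from {i , j} ij∈ with ∈-++⁻ (column a) ij∈
  ... | inj₁ ij∈col = let i≤a , j≡0 = ∈-column⁻ ij∈col in
    ∈-rectangle⁺ (s≤s i≤a) (subst (_< suc b) (sym j≡0) (s≤s z≤n))
  ... | inj₂ ij∈sh with ∈-shift⁻ ij∈sh
  ...   | j′ , refl , ij′∈ = let i< , j′< = ∈-rectangle⁻ (suc a) b ij′∈ in ∈-rectangle⁺ i< (s≤s j′<)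

ideal-reaches-column : ∀ {I} → Ideal₂ I → ∀ {i j} → (i , j) ∈ I → (i , 0) ∈ I
ideal-reaches-column closed {j = zero}  ij∈ = ij∈
ideal-reaches-column closed {j = suc j} ij∈ =
  ideal-reaches-column closed (All.lookup closed ij∈ (∈-below₂⁺ step-j))

ideal-column-down : ∀ {I} → Ideal₂ I → ∀ {i i′} → i′ ≤ i → (i , 0) ∈ I → (i′ , 0) ∈ I
ideal-column-down closed {zero}  z≤n i∈ = i∈
ideal-column-down closed {suc i} i′≤ i∈ with ℕP.m≤n⇒m<n∨m≡n i′≤
... | inj₂ refl      = i∈
... | inj₁ (s≤s i′≤) = ideal-column-down closed i′≤ (All.lookup closed i∈ (∈-below₂⁺ step-i))

shift-⋖₂ : ∀ {p t} → p ⋖₂ t → shift p ⋖₂ shift t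
shift-⋖₂ step-i = step-i
shift-⋖₂ step-j = step-j

Ideal₂-column-shift : ∀ {a b I} → I ⊆ rectangle (suc a) b →
                      Ideal₂ (column a ++ map shift I) ⇔ Ideal₂ I
Ideal₂-column-shift {a} {b} {I} I⊆ = mk⇔
  (λ closed → All.tabulate λ t∈ {p} p∈ →
     unshift (All.lookup closed (∈-++⁺ʳ (column a) (∈-map⁺ shift t∈)) (∈-below₂⁺ (shift-⋖₂ (∈-below₂⁻ p∈)))))
  (λ closed → All.++⁺ (All.tabulate column-closed) (All.map⁺ (All.tabulate (shifted-closed closed))))
  where
  unshift : ∀ {p} → shift p ∈ column a ++ map shift I → p ∈ I
  unshift sp∈ with ∈-++⁻ (column a) sp∈
  ... | inj₁ sp∈col = case proj₂ (∈-column⁻ sp∈col) of λ ()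
  ... | inj₂ sp∈sh  = let _ , p′∈ , sp≡sp′ = ∈-map⁻ shift sp∈sh in
                      subst (_∈ I) (sym (shift-injective sp≡sp′)) p′∈
  column-closed : ∀ {t} → t ∈ column a → below₂ t ⊆ column a ++ map shift I
  column-closed {i , j} t∈ p∈ with ∈-column⁻ t∈ | ∈-below₂⁻ p∈
  ... | i≤a , refl | step-i = ∈-++⁺ˡ (∈-column⁺ (ℕP.≤-trans (ℕP.n≤1+n _) i≤a))
  shifted-closed : Ideal₂ I → ∀ {t} → t ∈ I → below₂ (shift t) ⊆ column a ++ map shift I
  shifted-closed closed {i , j} t∈ p∈ with ∈-below₂⁻ p∈
  ... | step-i = ∈-++⁺ʳ (column a) (∈-map⁺ shift (All.lookup closed t∈ (∈-below₂⁺ step-i)))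
  shifted-closed closed {i , zero}  t∈ p∈ | step-j =
    ∈-++⁺ˡ (∈-column⁺ (ℕP.≤-pred (proj₁ (∈-rectangle⁻ (suc a) b (I⊆ t∈)))))
  shifted-closed closed {i , suc j} t∈ p∈ | step-j =
    ∈-++⁺ʳ (column a) (∈-map⁺ shift (All.lookup closed t∈ (∈-below₂⁺ step-j)))

gauss : ℕ → ℕ → ℕ → ℕ
gauss q zero    b       = 1
gauss q (suc a) zero    = 1
gauss q (suc a) (suc b) = gauss q a (suc b) + q ^ suc a * gauss q (suc a) b

Corner : ℕ → List (ℕ × ℕ) → Set
Corner a I = (a , 0) ∈ I

corner? : ∀ a → Decidable (Corner a)
corner? a I = (a , 0) ∈? I

module _ (q : ℕ) where

  GF-corner-out : ∀ a b → GF (ideal₂? ∩? ∁? (corner? a)) (rectangle (suc a) (suc b)) q ≡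
                          GF ideal₂? (rectangle a (suc b)) q
  GF-corner-out a b = begin
    GF P? (rectangle (suc a) (suc b)) q
      ≡⟨ GF-↭ P? q respects-↭ (rectangle-↭-row a (suc b)) ⟩
    GF P? (row a (suc b) ++ rectangle a (suc b)) q
      ≡⟨ GF-avoid P? q (row a (suc b)) (rectangle a (suc b)) avoids ⟩
    GF P? (rectangle a (suc b)) q
      ≡⟨ GF-cong P? q ideal₂? (rectangle a (suc b)) (λ I⊆ → mk⇔ proj₁ (λ closed → closed , corner∉ I⊆)) ⟩
    GF ideal₂? (rectangle a (suc b)) q ∎
    where
    open ≡-Reasoning
    P? = ideal₂? ∩? ∁? (corner? a)
    respects-↭ : ∀ {I J} → I ↭ J → Ideal₂ I × ¬ Corner a I → Ideal₂ J × ¬ Corner a J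
    respects-↭ I↭J (closed , c∉) = DownClosed-resp-↭ I↭J closed , c∉ ∘ ↭.∈-resp-↭ (↭-sym I↭J)
    avoids : ∀ {I} → I ⊆ row a (suc b) ++ rectangle a (suc b) → Ideal₂ I × ¬ Corner a I →
             ∀ {z} → z ∈ row a (suc b) → z ∉ I
    avoids _ (closed , c∉) {i , j} z∈row z∈I with ∈-row⁻ z∈row
    ... | refl = c∉ (ideal-reaches-column closed z∈I)
    corner∉ : ∀ {I} → I ⊆ rectangle a (suc b) → ¬ Corner a I
    corner∉ I⊆ c∈ = ℕP.<-irrefl refl (proj₁ (∈-rectangle⁻ a (suc b) (I⊆ c∈)))

  GF-corner-in : ∀ a b → GF (ideal₂? ∩? corner? a) (rectangle (suc a) (suc b)) q ≡
                         q ^ suc a * GF ideal₂? (rectangle (suc a) b) q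
  GF-corner-in a b = begin
    GF P? (rectangle (suc a) (suc b)) q
      ≡⟨ GF-↭ P? q respects-↭ (rectangle-↭-column a b) ⟩
    GF P? (column a ++ map shift R) q
      ≡⟨ GF-forced P? q (column a) (map shift R) column-unique (column#shift a R) forced ⟩
    q ^ length (column a) * GF (P? ∘ (column a ++_)) (map shift R) q
      ≡⟨ cong₂ _*_ (cong (q ^_) length-column) (GF-map (P? ∘ (column a ++_)) q shift R) ⟩
    q ^ suc a * GF (P? ∘ (column a ++_) ∘ map shift) R q
      ≡⟨ cong (q ^ suc a *_) (GF-cong _ q ideal₂? R λ I⊆ →
           mk⇔ (Equivalence.to (Ideal₂-column-shift I⊆) ∘ proj₁)
               (λ closed → Equivalence.from (Ideal₂-column-shift I⊆) closed , ∈-++⁺ˡ (∈-column⁺ ℕP.≤-refl))) ⟩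
    q ^ suc a * GF ideal₂? R q ∎
    where
    open ≡-Reasoning
    R = rectangle (suc a) b
    P? = ideal₂? ∩? corner? a
    respects-↭ : ∀ {I J} → I ↭ J → Ideal₂ I × Corner a I → Ideal₂ J × Corner a J
    respects-↭ I↭J (closed , c∈) = DownClosed-resp-↭ I↭J closed , ↭.∈-resp-↭ I↭J c∈
    column-unique : Unique (column a)
    column-unique = Unique.map⁺ ,-injectiveˡ (Unique.upTo⁺ (suc a))
    length-column : length (column a) ≡ suc a
    length-column = trans (length-map _ (upTo (suc a))) (length-upTo (suc a))
    forced : ∀ {I} → I ⊆ column a ++ map shift R → Ideal₂ I × Corner a I → column a ⊆ I
    forced _ (closed , c∈) {i , j} z∈col with ∈-column⁻ z∈col
    ... | i≤a , refl = ideal-column-down closed i≤a c∈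

  GF-rectangle : ∀ a b → GF ideal₂? (rectangle a b) q ≡ gauss q a b
  GF-rectangle zero    b       = refl
  GF-rectangle (suc a) zero    = cong (λ U → GF ideal₂? U q) (rectangle-zeroʳ (suc a))
  GF-rectangle (suc a) (suc b) = begin
    GF ideal₂? (rectangle (suc a) (suc b)) q
      ≡⟨ GF-split ideal₂? q (corner? a) (rectangle (suc a) (suc b)) ⟩
    GF (ideal₂? ∩? corner? a) (rectangle (suc a) (suc b)) q +
    GF (ideal₂? ∩? ∁? (corner? a)) (rectangle (suc a) (suc b)) q
      ≡⟨ cong₂ _+_ (GF-corner-in a b) (GF-corner-out a b) ⟩
    q ^ suc a * GF ideal₂? (rectangle (suc a) b) q + GF ideal₂? (rectangle a (suc b)) q
      ≡⟨ cong₂ _+_ (cong (q ^ suc a *_) (GF-rectangle (suc a) b)) (GF-rectangle a (suc b)) ⟩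
    q ^ suc a * gauss q (suc a) b + gauss q a (suc b)
      ≡⟨ ℕP.+-comm (q ^ suc a * gauss q (suc a) b) _ ⟩
    gauss q (suc a) (suc b) ∎
    where open ≡-Reasoning

-- T_n({b,y}) as a disjoint union of rectangles

+≤⇒≤∸ : ∀ {a b m} → a + b ≤ m → b ≤ m ∸ a
+≤⇒≤∸ {a} {b} {m} a+b≤m = ℕP.m+n≤o⇒m≤o∸n b (subst (_≤ m) (ℕP.+-comm a b) a+b≤m)

≤∸⇒+≤ : ∀ {a b m} → a ≤ m → b ≤ m ∸ a → a + b ≤ m
≤∸⇒+≤ {a} {b} {m} a≤m b≤m∸a = ℕP.≤-trans (ℕP.+-monoʳ-≤ a b≤m∸a) (ℕP.≤-reflexive (ℕP.m+[n∸m]≡n a≤m))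

Point₃ : Set
Point₃ = ℕ × ℕ × ℕ

size : Point₃ → ℕ
size (x , i , j) = x + i + j

level : Point₃ → ℕ
level (x , i , j) = x + i

data _⋖₃_ : Point₃ → Point₃ → Set where
  step-i : ∀ {x i j} → (suc x , i , j) ⋖₃ (x , suc i , j)
  step-j : ∀ {x i j} → (x , i , j) ⋖₃ (x , i , suc j)

below₃ : Point₃ → List Point₃
below₃ (x , zero  , zero)  = []
below₃ (x , suc i , zero)  = (suc x , i , zero) ∷ []
below₃ (x , zero  , suc j) = (x , zero , j) ∷ []
below₃ (x , suc i , suc j) = (suc x , i , suc j) ∷ (x , suc i , j) ∷ []

∈-below₃⁺ : ∀ {p t} → p ⋖₃ t → p ∈ below₃ t
∈-below₃⁺ {t = x , suc i , zero}  step-i = here refl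
∈-below₃⁺ {t = x , suc i , suc j} step-i = here refl
∈-below₃⁺ {t = x , zero , suc j}  step-j = here refl
∈-below₃⁺ {t = x , suc i , suc j} step-j = there (here refl)

∈-below₃⁻ : ∀ {p t} → p ∈ below₃ t → p ⋖₃ t
∈-below₃⁻ {t = x , suc i , zero}  (here refl)         = step-i
∈-below₃⁻ {t = x , zero , suc j}  (here refl)         = step-j
∈-below₃⁻ {t = x , suc i , suc j} (here refl)         = step-i
∈-below₃⁻ {t = x , suc i , suc j} (there (here refl)) = step-j

⋖₃-level : ∀ {p t} → p ⋖₃ t → level p ≡ level t
⋖₃-level {t = x , suc i , _} step-i = sym (ℕP.+-suc x i)
⋖₃-level step-j = refl

⋖₃-size : ∀ {p t} → p ⋖₃ t → size p ≤ size t
⋖₃-size {t = x , suc i , j} step-i = ℕP.≤-reflexive (cong (_+ j) (sym (ℕP.+-suc x i)))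
⋖₃-size {t = x , i , suc j} step-j = ℕP.+-monoʳ-≤ (x + i) (ℕP.n≤1+n j)

Ideal₃ : List Point₃ → Set
Ideal₃ = DownClosed below₃

ideal₃? : Decidable Ideal₃
ideal₃? = downClosed? (≡-dec ℕ._≟_ (≡-dec ℕ._≟_ ℕ._≟_)) below₃

place : ℕ → ℕ × ℕ → Point₃
place s (i , j) = (s ∸ i , i , j)

place-injective : ∀ s {p p′} → place s p ≡ place s p′ → p ≡ p′
place-injective s refl = refl

below₃-place : ∀ s {i j p} → i ≤ s → p ∈ below₃ (place s (i , j)) ⇔ p ∈ map (place s) (below₂ (i , j))
below₃-place s {i} {j} i≤s = mk⇔ to from
  where
  to : ∀ {p} → p ∈ below₃ (place s (i , j)) → p ∈ map (place s) (below₂ (i , j))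
  to p∈ with ∈-below₃⁻ p∈
  ... | step-i {i = i′} = subst (λ x → (x , i′ , j) ∈ map (place s) (below₂ (i , j))) (ℕP.+-∸-assoc 1 i≤s)
                                (∈-map⁺ (place s) (∈-below₂⁺ step-i))
  ... | step-j = ∈-map⁺ (place s) (∈-below₂⁺ step-j)
  from : ∀ {p} → p ∈ map (place s) (below₂ (i , j)) → p ∈ below₃ (place s (i , j))
  from p∈ with ∈-map⁻ (place s) p∈
  ... | p′ , p′∈ , refl with ∈-below₂⁻ p′∈
  ...   | step-i {i = i′} = subst (λ x → (x , i′ , j) ∈ below₃ (place s (i , j))) (sym (ℕP.+-∸-assoc 1 i≤s))
                                  (∈-below₃⁺ step-i)
  ...   | step-j = ∈-below₃⁺ step-j

block : ℕ → ℕ → List Point₃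
block m s = map (place s) (rectangle (suc s) (suc (m ∸ s)))

blocks : ℕ → List Point₃
blocks m = concatMap (block m) (upTo (suc m))

level-block : ∀ m s {t} → t ∈ block m s → level t ≡ s
level-block m s t∈ with ∈-map⁻ (place s) t∈
... | (i , j) , ij∈ , refl = ℕP.m∸n+n≡m (ℕP.≤-pred (proj₁ (∈-rectangle⁻ (suc s) (suc (m ∸ s)) ij∈)))

level-blocks : ∀ m {ss t} → t ∈ concatMap (block m) ss → level t ∈ ss
level-blocks m {ss} t∈ =
  let s , s∈ , t∈block = find (∈-concatMap⁻ (block m) {xs = ss} t∈)
  in subst (_∈ ss) (sym (level-block m s t∈block)) s∈

size-blocks : ∀ m {t} → t ∈ blocks m → size t ≤ m
size-blocks m t∈ with find (∈-concatMap⁻ (block m) {xs = upTo (suc m)} t∈)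
... | s , s∈ , t∈block with ∈-map⁻ (place s) t∈block
...   | (i , j) , ij∈ , refl =
  let i<1+s , j<1+m∸s = ∈-rectangle⁻ (suc s) (suc (m ∸ s)) ij∈ in
  subst (λ k → k + j ≤ m) (sym (ℕP.m∸n+n≡m (ℕP.≤-pred i<1+s)))
        (≤∸⇒+≤ (ℕP.≤-pred (∈-upTo⁻ s∈)) (ℕP.≤-pred j<1+m∸s))

∈-blocks⁺ : ∀ m {t} → size t ≤ m → t ∈ blocks m
∈-blocks⁺ m {x , i , j} size≤m =
  ∈-concatMap⁺ (block m) (lose (∈-upTo⁺ (s≤s level≤m)) (subst (_∈ block m (x + i)) place≡
    (∈-map⁺ (place (x + i)) (∈-rectangle⁺ (s≤s (ℕP.m≤n+m i x)) (s≤s (+≤⇒≤∸ size≤m))))))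
  where
  level≤m : x + i ≤ m
  level≤m = ℕP.≤-trans (ℕP.m≤m+n (x + i) j) size≤m
  place≡ : place (x + i) (i , j) ≡ (x , i , j)
  place≡ = cong (_, i , j) (ℕP.m+n∸n≡m x i)

blocks-unique : ∀ m → Unique (blocks m)
blocks-unique m = concatMap-unique (block m) (Unique.upTo⁺ (suc m))
  (λ s → Unique.map⁺ (place-injective s) (rectangle-unique (suc s) (suc (m ∸ s))))
  (λ {s} {s′} t∈ t∈′ → trans (sym (level-block m s t∈)) (level-block m s′ t∈′))

module _ (q : ℕ) where

  GF-block : ∀ m s → GF ideal₃? (block m s) q ≡ gauss q (suc s) (suc (m ∸ s))
  GF-block m s = begin
    GF ideal₃? (map (place s) R) q
      ≡⟨ GF-map ideal₃? q (place s) R ⟩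
    GF (ideal₃? ∘ map (place s)) R q
      ≡⟨ GF-cong _ q ideal₂? R (DownClosed-map (place s) (place-injective s) place-covers) ⟩
    GF ideal₂? R q
      ≡⟨ GF-rectangle q (suc s) (suc (m ∸ s)) ⟩
    gauss q (suc s) (suc (m ∸ s)) ∎
    where
    open ≡-Reasoning
    R = rectangle (suc s) (suc (m ∸ s))
    place-covers : ∀ {t p} → t ∈ R → p ∈ below₃ (place s t) ⇔ p ∈ map (place s) (below₂ t)
    place-covers {i , j} t∈ = below₃-place s (ℕP.≤-pred (proj₁ (∈-rectangle⁻ (suc s) _ t∈)))

  GF-blocks : ∀ m → GF ideal₃? (blocks m) q ≡
                    product (map (λ s → gauss q (suc s) (suc (m ∸ s))) (upTo (suc m)))
  GF-blocks m =
    trans (GF-concatMap ideal₃? q (block m) All.[] splits (upTo (suc m)) (Unique.upTo⁺ (suc m)))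
          (cong product (map-cong (GF-block m) (upTo (suc m))))
    where
    splits : ∀ {k ks I J} → k ∉ ks → I ⊆ block m k → J ⊆ concatMap (block m) ks →
             Ideal₃ (I ++ J) ⇔ (Ideal₃ I × Ideal₃ J)
    splits {k} {ks} k∉ks I⊆ J⊆ = DownClosed-++
      (λ t∈I p∈ p∈J → k∉ks (subst (_∈ ks) (trans (⋖₃-level (∈-below₃⁻ p∈)) (level-block m k (I⊆ t∈I)))
                                         (level-blocks m (J⊆ p∈J))))
      (λ t∈J p∈ p∈I → k∉ks (subst (_∈ ks) (trans (sym (⋖₃-level (∈-below₃⁻ p∈))) (level-block m k (I⊆ p∈I)))
                                         (level-blocks m (J⊆ t∈J))))

-- From T_n(S) to T_n({b,y})

fiber : ℕ → ℕ → ℕ → List Point₃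
fiber m a b = map (λ c → a , b , c) (upTo (suc (m ∸ a ∸ b)))

slice : ℕ → ℕ → List Point₃
slice m a = concatMap (fiber m a) (upTo (suc (m ∸ a)))

triangle : ℕ → List Point₃
triangle m = concatMap (slice m) (upTo (suc m))

ψ : Point₃ → Pt
ψ (a , b , c) = + a , + b , + c

Tlist-triangle : ∀ m → Tlist (suc (suc m)) ≡ map ψ (triangle m)
Tlist-triangle m = sym (trans (map-concatMap ψ (slice m) (upTo (suc m)))
  (concatMap-cong (λ a → trans (map-concatMap ψ (fiber m a) (upTo (suc (m ∸ a))))
     (concatMap-cong (λ b → sym (map-∘ (upTo (suc (m ∸ a ∸ b))))) (upTo (suc (m ∸ a))))) (upTo (suc m))))

∈-triangle⁻ : ∀ m {t} → t ∈ triangle m → size t ≤ m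
∈-triangle⁻ m t∈ with find (∈-concatMap⁻ (slice m) {xs = upTo (suc m)} t∈)
... | a , a∈ , t∈slice with find (∈-concatMap⁻ (fiber m a) {xs = upTo (suc (m ∸ a))} t∈slice)
...   | b , b∈ , t∈fiber with ∈-map⁻ (λ c → a , b , c) t∈fiber
...     | c , c∈ , refl = ≤∸⇒+≤ (≤∸⇒+≤ (ℕP.≤-pred (∈-upTo⁻ a∈)) (ℕP.≤-pred (∈-upTo⁻ b∈)))
                                (subst (c ≤_) (ℕP.∸-+-assoc m a b) (ℕP.≤-pred (∈-upTo⁻ c∈)))

∈-triangle⁺ : ∀ m {t} → size t ≤ m → t ∈ triangle m
∈-triangle⁺ m {a , b , c} size≤m =
  ∈-concatMap⁺ (slice m) (lose (∈-upTo⁺ (s≤s a≤m))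
    (∈-concatMap⁺ (fiber m a) (lose (∈-upTo⁺ (s≤s (+≤⇒≤∸ a+b≤m)))
      (∈-map⁺ (λ c → a , b , c) (∈-upTo⁺ (s≤s (subst (c ≤_) (sym (ℕP.∸-+-assoc m a b)) (+≤⇒≤∸ size≤m))))))))
  where
  a+b≤m = ℕP.≤-trans (ℕP.m≤m+n (a + b) c) size≤m
  a≤m   = ℕP.≤-trans (ℕP.m≤m+n a b) a+b≤m

triangle-unique : ∀ m → Unique (triangle m)
triangle-unique m = concatMap-unique (slice m) (Unique.upTo⁺ (suc m))
  (λ a → concatMap-unique (fiber m a) (Unique.upTo⁺ (suc (m ∸ a)))
     (λ b → Unique.map⁺ (,-injectiveʳ ∘ ,-injectiveʳ) (Unique.upTo⁺ _))
     (λ t∈ t∈′ → trans (sym (fiber-b t∈)) (fiber-b t∈′)))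
  (λ t∈ t∈′ → trans (sym (slice-a t∈)) (slice-a t∈′))
  where
  fiber-b : ∀ {a b t} → t ∈ fiber m a b → proj₁ (proj₂ t) ≡ b
  fiber-b t∈ with ∈-map⁻ _ t∈
  ... | _ , _ , refl = refl
  slice-a : ∀ {a t} → t ∈ slice m a → proj₁ t ≡ a
  slice-a {a} t∈ with find (∈-concatMap⁻ (fiber m a) {xs = upTo (suc (m ∸ a))} t∈)
  ... | _ , _ , t∈fiber with ∈-map⁻ _ t∈fiber
  ...   | _ , _ , refl = refl

triangle-↭ : ∀ (Φ : Point₃ → Point₃) → (∀ t → Φ (Φ t) ≡ t) → (∀ t → size (Φ t) ≡ size t) →
             ∀ m → triangle m ↭ map Φ (blocks m)
triangle-↭ Φ Φ-involutive size-Φ m = ↭-from-∈ (triangle-unique m)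
  (Unique.map⁺ Φ-injective (blocks-unique m)) (mk⇔ to from)
  where
  Φ-injective : ∀ {t u} → Φ t ≡ Φ u → t ≡ u
  Φ-injective {t} {u} Φt≡Φu = trans (sym (Φ-involutive t)) (trans (cong Φ Φt≡Φu) (Φ-involutive u))
  to : ∀ {t} → t ∈ triangle m → t ∈ map Φ (blocks m)
  to {t} t∈ = subst (_∈ map Φ (blocks m)) (Φ-involutive t)
    (∈-map⁺ Φ (∈-blocks⁺ m (subst (_≤ m) (sym (size-Φ t)) (∈-triangle⁻ m t∈))))
  from : ∀ {t} → t ∈ map Φ (blocks m) → t ∈ triangle m
  from t∈ with ∈-map⁻ Φ t∈
  ... | u , u∈ , refl = ∈-triangle⁺ m (subst (_≤ m) (sym (size-Φ u)) (size-blocks m u∈))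

InT-ψ : ∀ m t → size t ≤ m → InT (suc (suc m)) (ψ t)
InT-ψ m t size≤m = +≤+ z≤n , +≤+ z≤n , +≤+ z≤n , +≤+ size≤m

InT⇒ψ : ∀ {n x} → InT n x → ∃[ t ] x ≡ ψ t
InT⇒ψ {x = + a , + b , + c} _ = (a , b , c) , refl

coordinates : ∀ {a b c a′ b′ c′ : ℤ} → (a , b , c) ≡ (a′ , b′ , c′) → a ≡ a′ × b ≡ b′ × c ≡ c′
coordinates refl = refl , refl , refl

ψ-injective : ∀ {t u} → ψ t ≡ ψ u → t ≡ u
ψ-injective {a , b , c} {a′ , b′ , c′} ψt≡ψu = let a≡ , b≡ , c≡ = coordinates ψt≡ψu in
  cong₂ _,_ (ℤP.+-injective a≡) (cong₂ _,_ (ℤP.+-injective b≡) (ℤP.+-injective c≡))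

IsIdeal-resp-↭ : ∀ S n → IsIdeal S n Respects _↭_
IsIdeal-resp-↭ S n I↭J ideal x y x≤y y∈J = ↭.∈-resp-↭ I↭J (ideal x y x≤y (↭.∈-resp-↭ (↭-sym I↭J) y∈J))

+x≡+a+0⇒x≡a : ∀ {x a} → + x ≡ + a ℤ.+ + 0 → x ≡ a
+x≡+a+0⇒x≡a {x} {a} e = trans (ℤP.+-injective e) (ℕP.+-identityʳ a)

+x≡+a+1⇒x≡1+a : ∀ {x a} → + x ≡ + a ℤ.+ + 1 → x ≡ suc a
+x≡+a+1⇒x≡1+a {x} {a} e = trans (ℤP.+-injective e) (ℕP.+-comm a 1)

+x≡+a-1⇒a≡1+x : ∀ {x} a → + x ≡ + a ℤ.+ -[1+ 0 ] → a ≡ suc x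
+x≡+a-1⇒a≡1+x (suc a) e = cong suc (sym (ℤP.+-injective e))

+x≡+x+0 : ∀ x → + x ≡ + x ℤ.+ + 0
+x≡+x+0 x = sym (ℤP.+-identityʳ (+ x))

+[1+x]≡+x+1 : ∀ x → + suc x ≡ + x ℤ.+ + 1
+[1+x]≡+x+1 x = cong +_ (ℕP.+-comm 1 x)

module ColourTransfer (S : List Color) (Φ : Point₃ → Point₃)
  (Φ-involutive : ∀ t → Φ (Φ t) ≡ t) (size-Φ : ∀ t → size (Φ t) ≡ size t)
  (⋖⇒cover : ∀ {p t} → p ⋖₃ t → ∃[ c ] (c ∈ S × ψ (Φ t) ≡ ψ (Φ p) +₃ vec c))
  (cover⇒⋖ : ∀ {p t c} → c ∈ S → ψ (Φ t) ≡ ψ (Φ p) +₃ vec c → p ⋖₃ t)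
  where

  embed : Point₃ → Pt
  embed = ψ ∘ Φ

  embed-injective : ∀ {t u} → embed t ≡ embed u → t ≡ u
  embed-injective {t} {u} e =
    trans (sym (Φ-involutive t)) (trans (cong Φ (ψ-injective e)) (Φ-involutive u))

  module _ (m : ℕ) where

    private
      n = suc (suc m)

    InT-embed : ∀ t → size t ≤ m → InT n (embed t)
    InT-embed t size≤m = InT-ψ m (Φ t) (subst (_≤ m) (sym (size-Φ t)) size≤m)

    IsIdeal⇔Ideal₃ : ∀ {I} → I ⊆ blocks m → IsIdeal S n (map embed I) ⇔ Ideal₃ I
    IsIdeal⇔Ideal₃ {I} I⊆ = mk⇔
      (λ ideal → All.tabulate λ {t} t∈ {p} p∈ →
        let p⋖t = ∈-below₃⁻ p∈
            c , c∈ , t≡p+c = ⋖⇒cover p⋖t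
            size-t = size-blocks m (I⊆ t∈)
            cover : Cover S n (embed p) (embed t)
            cover = InT-embed p (ℕP.≤-trans (⋖₃-size p⋖t) size-t) , InT-embed t size-t , c , c∈ , t≡p+c
        in unembed (ideal (embed p) (embed t) (cover ◅ ε) (∈-map⁺ embed t∈)))
      ideal
      where
      unembed : ∀ {p} → embed p ∈ map embed I → p ∈ I
      unembed p∈ = let p′ , p′∈ , e = ∈-map⁻ embed p∈ in subst (_∈ I) (sym (embed-injective e)) p′∈
      cover-step : Ideal₃ I → ∀ {x z} → Cover S n x z → z ∈ map embed I → x ∈ map embed I
      cover-step closed (InT-x , _ , c , c∈ , z≡x+c) z∈ with ∈-map⁻ embed z∈ | InT⇒ψ {n} InT-x
      ... | t , t∈ , refl | u , refl =
        subst (_∈ map embed I) (cong ψ (Φ-involutive u))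
          (∈-map⁺ embed (All.lookup closed t∈ (∈-below₃⁺ (cover⇒⋖ c∈
            (subst (λ v → embed t ≡ ψ v +₃ vec c) (sym (Φ-involutive u)) z≡x+c)))))
      ideal : Ideal₃ I → IsIdeal S n (map embed I)
      ideal closed x .x ε            y∈ = y∈
      ideal closed x y  (cover ◅ x≤y) y∈ = cover-step closed cover (ideal closed _ y x≤y y∈)

    F≡GF-blocks : ∀ q → F S n q ≡ GF ideal₃? (blocks m) q
    F≡GF-blocks q = begin
      F S n q
        ≡⟨ ∑-filter (IsIdeal? S n) (λ I → q ^ length I) (subsets (Tlist n)) ⟩
      GF (IsIdeal? S n) (Tlist n) q
        ≡⟨ cong (λ U → GF (IsIdeal? S n) U q) (Tlist-triangle m) ⟩
      GF (IsIdeal? S n) (map ψ (triangle m)) q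
        ≡⟨ GF-↭ (IsIdeal? S n) q (IsIdeal-resp-↭ S n) (↭.map⁺ ψ (triangle-↭ Φ Φ-involutive size-Φ m)) ⟩
      GF (IsIdeal? S n) (map ψ (map Φ (blocks m))) q
        ≡⟨ cong (λ U → GF (IsIdeal? S n) U q) (map-∘ (blocks m)) ⟨
      GF (IsIdeal? S n) (map embed (blocks m)) q
        ≡⟨ GF-map (IsIdeal? S n) q embed (blocks m) ⟩
      GF (IsIdeal? S n ∘ map embed) (blocks m) q
        ≡⟨ GF-cong _ q ideal₃? (blocks m) IsIdeal⇔Ideal₃ ⟩
      GF ideal₃? (blocks m) q ∎
      where open ≡-Reasoning

bY-⋖⇒cover : ∀ {p t} → p ⋖₃ t → ∃[ c ] (c ∈ bY × ψ t ≡ ψ p +₃ vec c)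
bY-⋖⇒cover {t = x , suc i , j} step-i =
  blue , here refl , cong₂ _,_ refl (cong₂ _,_ (+[1+x]≡+x+1 i) (+x≡+x+0 j))
bY-⋖⇒cover {t = x , i , suc j} step-j =
  yellow , there (here refl) , cong₂ _,_ (+x≡+x+0 x) (cong₂ _,_ (+x≡+x+0 i) (+[1+x]≡+x+1 j))

bY-cover⇒⋖ : ∀ {p t c} → c ∈ bY → ψ t ≡ ψ p +₃ vec c → p ⋖₃ t
bY-cover⇒⋖ {x′ , _ , _} (here refl) e with coordinates e
... | e₁ , e₂ , e₃ with +x≡+a-1⇒a≡1+x x′ e₁ | +x≡+a+1⇒x≡1+a e₂ | +x≡+a+0⇒x≡a e₃
...   | refl | refl | refl = step-i
bY-cover⇒⋖ (there (here refl)) e with coordinates e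
... | e₁ , e₂ , e₃ with +x≡+a+0⇒x≡a e₁ | +x≡+a+0⇒x≡a e₂ | +x≡+a+1⇒x≡1+a e₃
...   | refl | refl | refl = step-j

swap₂₃ : Point₃ → Point₃
swap₂₃ (x , i , j) = x , j , i

gO-⋖⇒cover : ∀ {p t} → p ⋖₃ t → ∃[ c ] (c ∈ gO × ψ (swap₂₃ t) ≡ ψ (swap₂₃ p) +₃ vec c)
gO-⋖⇒cover {t = x , suc i , j} step-i =
  orange , there (here refl) , cong₂ _,_ refl (cong₂ _,_ (+x≡+x+0 j) (+[1+x]≡+x+1 i))
gO-⋖⇒cover {t = x , i , suc j} step-j =
  green , here refl , cong₂ _,_ (+x≡+x+0 x) (cong₂ _,_ (+[1+x]≡+x+1 j) (+x≡+x+0 i))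

gO-cover⇒⋖ : ∀ {p t c} → c ∈ gO → ψ (swap₂₃ t) ≡ ψ (swap₂₃ p) +₃ vec c → p ⋖₃ t
gO-cover⇒⋖ (here refl) e with coordinates e
... | e₁ , e₂ , e₃ with +x≡+a+0⇒x≡a e₁ | +x≡+a+1⇒x≡1+a e₂ | +x≡+a+0⇒x≡a e₃
...   | refl | refl | refl = step-j
gO-cover⇒⋖ {x′ , _ , _} (there (here refl)) e with coordinates e
... | e₁ , e₂ , e₃ with +x≡+a-1⇒a≡1+x x′ e₁ | +x≡+a+0⇒x≡a e₂ | +x≡+a+1⇒x≡1+a e₃
...   | refl | refl | refl = step-i

swap₁₃ : Point₃ → Point₃
swap₁₃ (x , i , j) = j , i , x

rS-⋖⇒cover : ∀ {p t} → p ⋖₃ t → ∃[ c ] (c ∈ rS × ψ (swap₁₃ t) ≡ ψ (swap₁₃ p) +₃ vec c)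
rS-⋖⇒cover {t = x , suc i , j} step-i =
  silver , there (here refl) , cong₂ _,_ (+x≡+x+0 j) (cong₂ _,_ (+[1+x]≡+x+1 i) refl)
rS-⋖⇒cover {t = x , i , suc j} step-j =
  red , here refl , cong₂ _,_ (+[1+x]≡+x+1 j) (cong₂ _,_ (+x≡+x+0 i) (+x≡+x+0 x))

rS-cover⇒⋖ : ∀ {p t c} → c ∈ rS → ψ (swap₁₃ t) ≡ ψ (swap₁₃ p) +₃ vec c → p ⋖₃ t
rS-cover⇒⋖ (here refl) e with coordinates e
... | e₁ , e₂ , e₃ with +x≡+a+1⇒x≡1+a e₁ | +x≡+a+0⇒x≡a e₂ | +x≡+a+0⇒x≡a e₃
...   | refl | refl | refl = step-j
rS-cover⇒⋖ {x′ , _ , _} (there (here refl)) e with coordinates e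
... | e₁ , e₂ , e₃ with +x≡+a+0⇒x≡a e₁ | +x≡+a+1⇒x≡1+a e₂ | +x≡+a-1⇒a≡1+x x′ e₃
...   | refl | refl | refl = step-i

size-swap₂₃ : ∀ t → size (swap₂₃ t) ≡ size t
size-swap₂₃ (x , i , j) =
  trans (ℕP.+-assoc x j i) (trans (cong (λ k → x + k) (ℕP.+-comm j i)) (sym (ℕP.+-assoc x i j)))

size-swap₁₃ : ∀ t → size (swap₁₃ t) ≡ size t
size-swap₁₃ (x , i , j) =
  trans (ℕP.+-comm (j + i) x) (trans (cong (λ k → x + k) (ℕP.+-comm j i)) (sym (ℕP.+-assoc x i j)))

module TransferbY = ColourTransfer bY (λ t → t) (λ _ → refl) (λ _ → refl) bY-⋖⇒cover bY-cover⇒⋖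
module TransfergO = ColourTransfer gO swap₂₃ (λ _ → refl) size-swap₂₃ gO-⋖⇒cover gO-cover⇒⋖
module TransferrS = ColourTransfer rS swap₁₃ (λ _ → refl) size-swap₁₃ rS-⋖⇒cover rS-cover⇒⋖

-- Identities between q-factorials

∏ : (ℕ → ℕ) → ℕ → ℕ
∏ f n = product (applyUpTo f n)

∏-snoc : ∀ f n → ∏ f (suc n) ≡ ∏ f n * f n
∏-snoc f n = begin
  product (applyUpTo f (suc n))     ≡⟨ cong product (applyUpTo-∷ʳ f n) ⟨
  product (applyUpTo f n ++ f n ∷ []) ≡⟨ product-++ (applyUpTo f n) (f n ∷ []) ⟩
  ∏ f n * (f n * 1)                 ≡⟨ cong (∏ f n *_) (ℕP.*-identityʳ (f n)) ⟩
  ∏ f n * f n                       ∎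
  where open ≡-Reasoning

∏-* : ∀ f g n → ∏ (λ i → f i * g i) n ≡ ∏ f n * ∏ g n
∏-* f g zero    = refl
∏-* f g (suc n) = trans (cong (f 0 * g 0 *_) (∏-* (f ∘ suc) (g ∘ suc) n))
  (solve 4 (λ a b c d → (a :* b) :* (c :* d) := (a :* c) :* (b :* d)) refl
     (f 0) (g 0) (∏ (f ∘ suc) n) (∏ (g ∘ suc) n))

∏-cong : ∀ {f g} n → (∀ {i} → i < n → f i ≡ g i) → ∏ f n ≡ ∏ g n
∏-cong zero    f≡g = refl
∏-cong (suc n) f≡g = cong₂ _*_ (f≡g (s≤s z≤n)) (∏-cong n (f≡g ∘ s≤s))

∏-const : ∀ c n → ∏ (λ _ → c) n ≡ c ^ n
∏-const c zero    = refl
∏-const c (suc n) = cong (c *_) (∏-const c n)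

∏-reverse : ∀ f n → ∏ (λ i → f (n ∸ suc i)) n ≡ ∏ f n
∏-reverse f zero    = refl
∏-reverse f (suc n) = trans (cong (f n *_) (∏-reverse f n))
                            (trans (ℕP.*-comm (f n) _) (sym (∏-snoc f n)))

qint-suc : ∀ m q → qint (suc m) q ≡ 1 + q * qint m q
qint-suc m q = cong suc (trans
  (cong sum (trans (map-applyUpTo suc (q ^_) m) (sym (map-applyUpTo (λ i → i) (λ i → q * q ^ i) m))))
  (∑-*ˡ (upTo m) q (q ^_)))

qint-+ : ∀ m n q → qint (m + n) q ≡ qint m q + q ^ m * qint n q
qint-+ zero    n q = sym (ℕP.+-identityʳ _)
qint-+ (suc m) n q = begin
  qint (suc (m + n)) q
    ≡⟨ qint-suc (m + n) q ⟩
  1 + q * qint (m + n) q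
    ≡⟨ cong (λ k → 1 + q * k) (qint-+ m n q) ⟩
  1 + q * (qint m q + q ^ m * qint n q)
    ≡⟨ solve 4 (λ q a b c → con 1 :+ q :* (a :+ b :* c) := (con 1 :+ q :* a) :+ (q :* b) :* c) refl
         q (qint m q) (q ^ m) (qint n q) ⟩
  (1 + q * qint m q) + q ^ suc m * qint n q
    ≡⟨ cong (_+ q ^ suc m * qint n q) (qint-suc m q) ⟨
  qint (suc m) q + q ^ suc m * qint n q ∎
  where open ≡-Reasoning

gauss-qfact : ∀ q a b → gauss q a b * (qfact a q * qfact b q) ≡ qfact (a + b) q
gauss-qfact q zero    b    = trans (ℕP.+-identityʳ _) (ℕP.+-identityʳ _)
gauss-qfact q (suc a) zero =
  trans (ℕP.+-identityʳ _) (trans (ℕP.*-identityʳ _) (cong (λ k → qfact k q) (sym (ℕP.+-identityʳ (suc a)))))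
gauss-qfact q (suc a) (suc b) = begin
  (G₁ + q ^ suc a * G₂) * ((Fa * [a+1]) * (Fb * [b+1]))
    ≡⟨ solve 7 (λ G₁ Q G₂ Fa ta Fb tb → (G₁ :+ Q :* G₂) :* ((Fa :* ta) :* (Fb :* tb))
                  := (G₁ :* (Fa :* (Fb :* tb))) :* ta :+ Q :* (G₂ :* ((Fa :* ta) :* Fb)) :* tb) refl
         G₁ (q ^ suc a) G₂ Fa [a+1] Fb [b+1] ⟩
  (G₁ * (Fa * (Fb * [b+1]))) * [a+1] + q ^ suc a * (G₂ * ((Fa * [a+1]) * Fb)) * [b+1]
    ≡⟨ cong₂ (λ x y → x * [a+1] + q ^ suc a * y * [b+1]) (gauss-qfact q a (suc b)) (gauss-qfact q (suc a) b) ⟩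
  qfact (a + suc b) q * [a+1] + q ^ suc a * N * [b+1]
    ≡⟨ cong (λ k → qfact k q * [a+1] + q ^ suc a * N * [b+1]) (ℕP.+-suc a b) ⟩
  N * [a+1] + q ^ suc a * N * [b+1]
    ≡⟨ solve 4 (λ N ta Q tb → N :* ta :+ Q :* N :* tb := N :* (ta :+ Q :* tb)) refl N [a+1] (q ^ suc a) [b+1] ⟩
  N * ([a+1] + q ^ suc a * [b+1])
    ≡⟨ cong (N *_) (qint-+ (suc a) (suc b) q) ⟨
  N * qint (suc a + suc b) q
    ≡⟨ cong (λ k → N * qint (suc k) q) (ℕP.+-suc a b) ⟩
  N * qint (suc (suc (a + b))) q
    ≡⟨ cong (λ k → qfact k q * qint (suc k) q) (ℕP.+-suc a b) ⟨
  qfact (suc a + suc b) q ∎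
  where
  open ≡-Reasoning
  G₁ = gauss q a (suc b)
  G₂ = gauss q (suc a) b
  Fa = qfact a q
  Fb = qfact b q
  [a+1] = qint (suc a) q
  [b+1] = qint (suc b) q
  N = qfact (suc (a + b)) q

gaussProduct : ℕ → ℕ → ℕ
gaussProduct q n = ∏ (λ i → gauss q (suc i) (n ∸ suc i)) n

binomDen : ℕ → ℕ → ℕ
binomDen q n = ∏ (λ i → qfact (suc i) q * qfact (n ∸ suc i) q) n

gaussProduct-binomDen : ∀ q n → gaussProduct q n * binomDen q n ≡ qfact n q ^ n
gaussProduct-binomDen q n = begin
  gaussProduct q n * binomDen q n
    ≡⟨ ∏-* (λ i → gauss q (suc i) (n ∸ suc i)) (λ i → qfact (suc i) q * qfact (n ∸ suc i) q) n ⟨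
  ∏ (λ i → gauss q (suc i) (n ∸ suc i) * (qfact (suc i) q * qfact (n ∸ suc i) q)) n
    ≡⟨ ∏-cong n (λ {i} i<n →
         trans (gauss-qfact q (suc i) (n ∸ suc i)) (cong (λ k → qfact k q) (ℕP.m+[n∸m]≡n i<n))) ⟩
  ∏ (λ _ → qfact n q) n
    ≡⟨ ∏-const (qfact n q) n ⟩
  qfact n q ^ n ∎
  where open ≡-Reasoning

*-^ : ∀ a b n → (a * b) ^ n ≡ a ^ n * b ^ n
*-^ a b n = trans (sym (∏-const (a * b) n))
  (trans (∏-* (λ _ → a) (λ _ → b) n) (cong₂ _*_ (∏-const a n) (∏-const b n)))

-- For k = 1 … n−1 the factor ∏_{1≤i≤j≤k} [j+1]/[j] of prodRatio n is rowNum (k−1) / rowDen (k−1).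
rowNum rowDen : ℕ → ℕ → ℕ
rowNum q k = ∏ (λ j → qint (suc (suc j)) q ^ suc j) (suc k)
rowDen q k = ∏ (λ j → qint (suc j) q ^ suc j) (suc k)

ratioNum ratioDen : ℕ → ℕ → ℕ
ratioNum q n = ∏ (rowNum q) (n ∸ 1)
ratioDen q n = ∏ (rowDen q) (n ∸ 1)

rowNum-rowDen : ∀ q k → qint (suc (suc k)) q ^ suc k * rowDen q k ≡ rowNum q k * qfact (suc k) q
rowNum-rowDen q zero =
  solve 1 (λ x → (x :^ 1) :* ((con 1 :* con 1) :* con 1) := ((x :* con 1) :* con 1) :* (con 1 :* con 1))
    refl (qint 2 q)
rowNum-rowDen q (suc k) = begin
  t′ ^ suc (suc k) * rowDen q (suc k)
    ≡⟨ cong (t′ ^ suc (suc k) *_) (∏-snoc (λ j → qint (suc j) q ^ suc j) (suc k)) ⟩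
  t′ ^ suc (suc k) * (rowDen q k * t ^ suc (suc k))
    ≡⟨ solve 4 (λ A D t B → A :* (D :* (t :* B)) := (A :* t) :* (B :* D)) refl
         (t′ ^ suc (suc k)) (rowDen q k) t (t ^ suc k) ⟩
  (t′ ^ suc (suc k) * t) * (t ^ suc k * rowDen q k)
    ≡⟨ cong ((t′ ^ suc (suc k) * t) *_) (rowNum-rowDen q k) ⟩
  (t′ ^ suc (suc k) * t) * (rowNum q k * fact)
    ≡⟨ solve 4 (λ A t N fact → (A :* t) :* (N :* fact) := (N :* A) :* (fact :* t)) refl
         (t′ ^ suc (suc k)) t (rowNum q k) fact ⟩
  (rowNum q k * t′ ^ suc (suc k)) * (fact * t)
    ≡⟨ cong (_* (fact * t)) (∏-snoc (λ j → qint (suc (suc j)) q ^ suc j) (suc k)) ⟨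
  rowNum q (suc k) * qfact (suc (suc k)) q ∎
  where
  open ≡-Reasoning
  t = qint (suc (suc k)) q
  t′ = qint (suc (suc (suc k))) q
  fact = qfact (suc k) q

factorials factorials₀ : ℕ → ℕ → ℕ
factorials  q n = ∏ (λ i → qfact (suc i) q) n
factorials₀ q n = ∏ (λ i → qfact i q) n

binomDen-factorials : ∀ q n → binomDen q n ≡ factorials q n * factorials₀ q n
binomDen-factorials q n = trans (∏-* (λ i → qfact (suc i) q) (λ i → qfact (n ∸ suc i) q) n)
                                (cong (factorials q n *_) (∏-reverse (λ i → qfact i q) n))

ratio-cross : ∀ q m → qfact (suc m) q ^ suc m * ∏ (rowDen q) m ≡
                      ∏ (rowNum q) m * (factorials q (suc m) * factorials₀ q (suc m))
ratio-cross q zero    = refl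
ratio-cross q (suc m) = begin
  (fact * t) ^ suc (suc m) * ∏ (rowDen q) (suc m)
    ≡⟨ cong₂ _*_ (*-^ fact t (suc (suc m))) (∏-snoc (rowDen q) m) ⟩
  ((fact * fact ^ suc m) * (t * t ^ suc m)) * (∏ (rowDen q) m * rowDen q m)
    ≡⟨ solve 6 (λ f fp t tp P D → ((f :* fp) :* (t :* tp)) :* (P :* D) := ((fp :* P) :* (tp :* D)) :* (f :* t)) refl
         fact (fact ^ suc m) t (t ^ suc m) (∏ (rowDen q) m) (rowDen q m) ⟩
  ((fact ^ suc m * ∏ (rowDen q) m) * (t ^ suc m * rowDen q m)) * (fact * t)
    ≡⟨ cong₂ (λ x y → (x * y) * (fact * t)) (ratio-cross q m) (rowNum-rowDen q m) ⟩
  ((∏ (rowNum q) m * (Fs * Fs₀)) * (rowNum q m * fact)) * (fact * t)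
    ≡⟨ solve 6 (λ PN A B N f t → ((PN :* (A :* B)) :* (N :* f)) :* (f :* t)
                              := (PN :* N) :* ((A :* (f :* t)) :* (B :* f))) refl
         (∏ (rowNum q) m) Fs Fs₀ (rowNum q m) fact t ⟩
  (∏ (rowNum q) m * rowNum q m) * ((Fs * (fact * t)) * (Fs₀ * fact))
    ≡⟨ cong₂ _*_ (∏-snoc (rowNum q) m)
                 (cong₂ _*_ (∏-snoc (λ i → qfact (suc i) q) (suc m)) (∏-snoc (λ i → qfact i q) (suc m))) ⟨
  ∏ (rowNum q) (suc m) * (factorials q (suc (suc m)) * factorials₀ q (suc (suc m))) ∎
  where
  open ≡-Reasoning
  t = qint (suc (suc m)) q
  fact = qfact (suc m) q
  Fs = factorials q (suc m)
  Fs₀ = factorials₀ q (suc m)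

binom-ratio-cross : ∀ q n → qfact n q ^ n * ratioDen q n ≡ ratioNum q n * binomDen q n
binom-ratio-cross q zero    = refl
binom-ratio-cross q (suc m) =
  trans (ratio-cross q m) (cong (∏ (rowNum q) m *_) (sym (binomDen-factorials q (suc m))))

infix 4 _≐_÷_

-- Compared in unnormalised form, so that products of fractions need no gcd reasoning.
_≐_÷_ : ℚ → ℕ → ℕ → Set
x ≐ N ÷ D = 0 < D × toℚᵘ x ≃ᵘ mkℚᵘ (+ N) (ℕ.pred D)

≐-/ : ∀ N D .{{_ : NonZero D}} → (+ N) ℚ./ D ≐ N ÷ D
≐-/ N (suc d) = s≤s z≤n , ℚP.toℚᵘ-fromℚᵘ (mkℚᵘ (+ N) d)

≐-* : ∀ {x y N₁ N₂ D₁ D₂} → x ≐ N₁ ÷ D₁ → y ≐ N₂ ÷ D₂ → x ℚ.* y ≐ N₁ * N₂ ÷ (D₁ * D₂)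
≐-* {x} {y} {N₁} {N₂} {suc d₁} {suc d₂} (_ , x≃) (_ , y≃) =
  s≤s z≤n ,
  ℚᵘP.≃-trans (ℚP.toℚᵘ-homo-* x y)
    (ℚᵘP.≃-trans (ℚᵘP.*-cong x≃ y≃)
      (ℚᵘP.≃-reflexive (cong (λ z → mkℚᵘ z (ℕ.pred (suc d₁ * suc d₂))) (sym (ℤP.pos-* N₁ N₂)))))

≐-cong : ∀ {x N N′ D D′} → N ≡ N′ → D ≡ D′ → x ≐ N ÷ D → x ≐ N′ ÷ D′
≐-cong refl refl x≐ = x≐

≐-unique : ∀ {x y N D N′ D′} → x ≐ N ÷ D → y ≐ N′ ÷ D′ → N * D′ ≡ N′ * D → x ≡ y
≐-unique {x} {y} {N} {suc d} {N′} {suc d′} (_ , x≃) (_ , y≃) cross =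
  ℚP.toℚᵘ-injective (ℚᵘP.≃-trans x≃ (ℚᵘP.≃-trans (*≡* ℤ-cross) (ℚᵘP.≃-sym y≃)))
  where
  ℤ-cross = trans (sym (ℤP.pos-* N (suc d′))) (trans (cong +_ cross) (ℤP.pos-* N′ (suc d)))

prodℚ-applyUpTo : ∀ (f : ℕ → ℚ) N D n → (∀ i → f i ≐ N i ÷ D i) → prodℚ (applyUpTo f n) ≐ ∏ N n ÷ ∏ D n
prodℚ-applyUpTo f N D zero    f≐ = s≤s z≤n , ℚᵘP.≃-refl
prodℚ-applyUpTo f N D (suc n) f≐ =
  ≐-* (f≐ 0) (prodℚ-applyUpTo (f ∘ suc) (N ∘ suc) (D ∘ suc) n (f≐ ∘ suc))

map-from1 : ∀ {A : Set} (f : ℕ → A) n → map f (from1 n) ≡ applyUpTo (f ∘ suc) n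
map-from1 f n = trans (sym (map-∘ (upTo n))) (map-upTo (f ∘ suc) n)

prodℚ-from1 : ∀ (f : ℕ → ℚ) N D n → (∀ i → f (suc i) ≐ N i ÷ D i) → prodℚ (map f (from1 n)) ≐ ∏ N n ÷ ∏ D n
prodℚ-from1 f N D n f≐ rewrite map-from1 f n = prodℚ-applyUpTo (f ∘ suc) N D n f≐

prodℚ-++ : ∀ xs ys → prodℚ (xs ++ ys) ≡ prodℚ xs ℚ.* prodℚ ys
prodℚ-++ []       ys = sym (ℚP.*-identityˡ _)
prodℚ-++ (x ∷ xs) ys = trans (cong (x ℚ.*_) (prodℚ-++ xs ys)) (sym (ℚP.*-assoc x _ _))

prodℚ-concatMap : ∀ {A : Set} (h : A → List ℚ) xs → prodℚ (concatMap h xs) ≡ prodℚ (map (prodℚ ∘ h) xs)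
prodℚ-concatMap h []       = refl
prodℚ-concatMap h (x ∷ xs) =
  trans (prodℚ-++ (h x) (concatMap h xs)) (cong (prodℚ (h x) ℚ.*_) (prodℚ-concatMap h xs))

prodℚ-concatMap-from1 : ∀ (h : ℕ → List ℚ) N D n → (∀ i → prodℚ (h (suc i)) ≐ N i ÷ D i) →
                        prodℚ (concatMap h (from1 n)) ≐ ∏ N n ÷ ∏ D n
prodℚ-concatMap-from1 h N D n h≐ rewrite prodℚ-concatMap h (from1 n) = prodℚ-from1 (prodℚ ∘ h) N D n h≐

prodBinom-≐ : ∀ n q → prodBinom n q ≐ qfact n q ^ n ÷ binomDen q n
prodBinom-≐ n q = ≐-cong (∏-const (qfact n q) n) refl
  (prodℚ-from1 (λ j → qbinom n j q) (λ _ → qfact n q) (λ i → qfact (suc i) q * qfact (n ∸ suc i) q) n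
    λ i → ≐-/ (qfact n q) (qfact (suc i) q * qfact (n ∸ suc i) q)
            {{ℕP.m*n≢0 (qfact (suc i) q) (qfact (n ∸ suc i) q) {{qfact-nz (suc i) q}} {{qfact-nz (n ∸ suc i) q}}}})

prodRatio-≐ : ∀ n q → prodRatio n q ≐ ratioNum q n ÷ ratioDen q n
prodRatio-≐ n q = prodℚ-concatMap-from1 ratioRow (rowNum q) (rowDen q) (n ∸ 1) λ k →
  prodℚ-concatMap-from1 entries _ _ (suc k) λ j →
    ≐-cong (∏-const _ (suc j)) (∏-const _ (suc j))
      (prodℚ-from1 (λ _ → qratio j q) (λ _ → qint (suc (suc j)) q) (λ _ → qint (suc j) q) (suc j)
        (λ _ → ≐-/ (qint (suc (suc j)) q) (qint (suc j) q)))
  where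
  entries : ℕ → List ℚ
  entries j = map (λ i → qratio (j ∸ 1) q) (from1 j)
  ratioRow : ℕ → List ℚ
  ratioRow k = concatMap entries (from1 k)

GF-blocks≡gaussProduct : ∀ q m → GF ideal₃? (blocks m) q ≡ gaussProduct q (suc (suc m))
GF-blocks≡gaussProduct q m = begin
  GF ideal₃? (blocks m) q
    ≡⟨ GF-blocks q m ⟩
  product (map (λ s → gauss q (suc s) (suc (m ∸ s))) (upTo (suc m)))
    ≡⟨ cong product (map-upTo _ (suc m)) ⟩
  ∏ (λ s → gauss q (suc s) (suc (m ∸ s))) (suc m)
    ≡⟨ ∏-cong (suc m) (λ {s} s<1+m → cong (gauss q (suc s)) (sym (ℕP.+-∸-assoc 1 (ℕP.≤-pred s<1+m)))) ⟩
  ∏ g (suc m)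
    ≡⟨ ℕP.*-identityʳ _ ⟨
  ∏ g (suc m) * gauss q (suc (suc m)) 0
    ≡⟨ cong (λ k → ∏ g (suc m) * gauss q (suc (suc m)) k) (ℕP.n∸n≡0 m) ⟨
  ∏ g (suc m) * g (suc m)
    ≡⟨ ∏-snoc g (suc m) ⟨
  gaussProduct q (suc (suc m)) ∎
  where
  open ≡-Reasoning
  g : ℕ → ℕ
  g i = gauss q (suc i) (suc (suc m) ∸ suc i)

F≡gaussProduct : ∀ n → n ≥ 1 → ∀ S → (S ≡ gO ⊎ S ≡ rS ⊎ S ≡ bY) → ∀ q → F S n q ≡ gaussProduct q n
F≡gaussProduct (suc zero)    _ S   _                  q = refl
F≡gaussProduct (suc (suc m)) _ .gO (inj₁ refl)        q =
  trans (TransfergO.F≡GF-blocks m q) (GF-blocks≡gaussProduct q m)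
F≡gaussProduct (suc (suc m)) _ .rS (inj₂ (inj₁ refl)) q =
  trans (TransferrS.F≡GF-blocks m q) (GF-blocks≡gaussProduct q m)
F≡gaussProduct (suc (suc m)) _ .bY (inj₂ (inj₂ refl)) q =
  trans (TransferbY.F≡GF-blocks m q) (GF-blocks≡gaussProduct q m)

theorem2p6 : (n : ℕ) → n ≥ 1 → (S : List Color) → (S ≡ gO ⊎ S ≡ rS ⊎ S ≡ bY) →
    (q : ℕ) → ((+ F S n q) / 1 ≡ prodBinom n q) × (prodBinom n q ≡ prodRatio n q)
theorem2p6 n n≥1 S S∈ q =
  ≐-unique (≐-/ (F S n q) 1) (prodBinom-≐ n q)
    (trans (cong (_* binomDen q n) (F≡gaussProduct n n≥1 S S∈ q))
           (trans (gaussProduct-binomDen q n) (sym (ℕP.*-identityʳ _)))) ,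
  ≐-unique (prodBinom-≐ n q) (prodRatio-≐ n q) (binom-ratio-cross q n)
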